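{- Let $(L,Q)$ be a definite ternary quadratic lattice over $A=\mathbb F_q[t]$ with reduced basis $(\mathbf v_1,\mathbf v_2,\mathbf v_3)$, and let $M=A\mathbf v_1+A\mathbf v_2\subset L$. Then for every $\mathbf w\in M\setminus\{0\}$, $$\deg B(\mathbf w,\mathbf v_3)<\deg Q(\mathbf w).$$
   Context: $\mathbb F_q$ is a finite field with $q$ odd, $A=\mathbb F_q[t]$, $K=\mathbb F_q(t)$, $K_\infty=\mathbb F_q((1/t))$. For $x\in K$, $\deg x$ is the degree of the numerator minus that of the denominator, $\deg 0=-\infty$. A quadratic lattice $(L,Q)$ over $A$ is a free $A$-module of finite rank with a $K$-valued quadratic form $Q$; $B(\mathbf x,\mathbf y)=Q(\mathbf x+\mathbf y)-Q(\mathbf x)-Q(\mathbf y)$. Ternary means rank 3; definite means $Q$ anisotropic over $K_\infty$. The Gram matrix of a basis $\mathbf v_1,\dots,\mathbf v_n$ is $(m_{ij})$, $m_{ij}=\frac12B(\mathbf v_i,\mathbf v_j)$; a basis is reduced if $\deg m_{ii}\le\deg m_{jj}$ for $i\le j$ and $\deg m_{ij}<\deg m_{ii}$ for $i<j$. -}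

module Defs where

open import Level using (Level; _⊔_) renaming (suc to lsuc)
open import Algebra.Bundles using (CommutativeRing)
open import Data.Nat as ℕ using (ℕ; zero; suc)
open import Data.Integer as ℤ using (ℤ; +_; -[1+_])
open import Data.Fin as Fin using (Fin)
open import Data.List using (List; []; _∷_; map; length)
open import Data.Maybe using (Maybe; just; nothing)
open import Data.Product using (∃; _×_)
open import Data.Bool using (if_then_else_)
open import Relation.Nullary using (¬_; does)
open import Relation.Binary using (Decidable)
open import Relation.Binary.PropositionalEquality using (_≡_)

record FiniteField (c ℓ : Level) : Set (lsuc (c ⊔ ℓ)) where
  field
    commRing : CommutativeRing c ℓ
  open CommutativeRing commRing public
  field
    _≟_       : Decidable _≈_
    1≉0       : ¬ (1# ≈ 0#)
    inverse   : ∀ x → ¬ (x ≈ 0#) → ∃ λ y → x * y ≈ 1#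
    q         : ℕ
    enum      : Fin q → Carrier
    enum-surj : ∀ x → ∃ λ i → enum i ≈ x
    enum-inj  : ∀ i j → enum i ≈ enum j → i ≡ j

-- Degrees take values in ℤ ∪ {-∞}, with -∞ represented by nothing.

Deg : Set
Deg = Maybe ℤ

data _≤ᵈ_ : Deg → Deg → Set where
  -∞≤ : ∀ {d} → nothing ≤ᵈ d
  fin≤ : ∀ {a b} → a ℤ.≤ b → just a ≤ᵈ just b

data _<ᵈ_ : Deg → Deg → Set where
  -∞< : ∀ {b} → nothing <ᵈ just b
  fin< : ∀ {a b} → a ℤ.< b → just a <ᵈ just b

module Over {c ℓ : Level} (F : FiniteField c ℓ) where
  open FiniteField F

  -- A = F_q[t] : coefficient lists, lowest degree first.
  Poly : Set c
  Poly = List Carrier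

  coeff : Poly → ℕ → Carrier
  coeff []      _       = 0#
  coeff (a ∷ p) zero    = a
  coeff (a ∷ p) (suc n) = coeff p n

  coeffℤ : Poly → ℤ → Carrier
  coeffℤ p (+ n)      = coeff p n
  coeffℤ p -[1+ n ]   = 0#

  IsZeroₚ : Poly → Set ℓ
  IsZeroₚ p = ∀ n → coeff p n ≈ 0#

  _≈ₚ_ : Poly → Poly → Set ℓ
  p ≈ₚ r = ∀ n → coeff p n ≈ coeff r n

  _+ₚ_ : Poly → Poly → Poly
  []      +ₚ r       = r
  (a ∷ p) +ₚ []      = a ∷ p
  (a ∷ p) +ₚ (b ∷ r) = (a + b) ∷ (p +ₚ r)

  -ₚ_ : Poly → Poly
  -ₚ p = map -_ p

  _*ₚ_ : Poly → Poly → Poly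
  []      *ₚ r = []
  (a ∷ p) *ₚ r = map (a *_) r +ₚ (0# ∷ (p *ₚ r))

  1ₚ : Poly
  1ₚ = 1# ∷ []

  0ₚ : Poly
  0ₚ = []

  degₚ : Poly → Maybe ℕ
  degₚ []      = nothing
  degₚ (a ∷ p) with degₚ p
  ... | just d  = just (suc d)
  ... | nothing = if does (a ≟ 0#) then nothing else just 0

  -- K = F_q(t): fractions num/den; an element of K is a fraction with
  -- nonzero denominator (predicate IsK).  Operations are the usual
  -- fraction formulas.
  record Frac : Set c where
    constructor _/_
    field
      num : Poly
      den : Poly
  open Frac public

  IsK : Frac → Set ℓ
  IsK x = ¬ IsZeroₚ (den x)

  _≈K_ : Frac → Frac → Set ℓ
  x ≈K y = (num x *ₚ den y) ≈ₚ (num y *ₚ den x)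

  _+K_ : Frac → Frac → Frac
  (a / b) +K (c / d) = ((a *ₚ d) +ₚ (c *ₚ b)) / (b *ₚ d)

  _*K_ : Frac → Frac → Frac
  (a / b) *K (c / d) = (a *ₚ c) / (b *ₚ d)

  -K_ : Frac → Frac
  -K (a / b) = (-ₚ a) / b

  ι : Poly → Frac
  ι p = p / 1ₚ

  degK : Frac → Deg
  degK (a / b) with degₚ a | degₚ b
  ... | nothing | _       = nothing
  ... | just m  | just n  = just (+ m ℤ.- + n)
  ... | just m  | nothing = nothing   -- never used for elements of K

  -- K_∞ = F_q((1/t)) : a Laurent series  Σ_{k ≥ 0} co k · t^(top − k).
  record K∞ : Set c where
    constructor laurent
    field
      top : ℕ
      co  : ℕ → Carrier

  coef∞ : K∞ → ℤ → Carrier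
  coef∞ (laurent N cf) j with + N ℤ.- j
  ... | + n      = cf n
  ... | -[1+ n ] = 0#

  _≈∞_ : K∞ → K∞ → Set ℓ
  x ≈∞ y = ∀ j → coef∞ x j ≈ coef∞ y j

  0∞ : K∞
  0∞ = laurent 0 (λ _ → 0#)

  _+∞_ : K∞ → K∞ → K∞
  x +∞ y = laurent N (λ k → coef∞ x (+ N ℤ.- + k) + coef∞ y (+ N ℤ.- + k))
    where N = ℕ._⊔_ (K∞.top x) (K∞.top y)

  sumTo : ℕ → (ℕ → Carrier) → Carrier
  sumTo zero    f = f 0
  sumTo (suc k) f = sumTo k f + f (suc k)

  _*∞_ : K∞ → K∞ → K∞
  laurent N₁ c₁ *∞ laurent N₂ c₂ =
    laurent (N₁ ℕ.+ N₂) (λ k → sumTo k (λ i → c₁ i * c₂ (k ℕ.∸ i)))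

  emb : Poly → K∞
  emb p = laurent (length p) (λ k → coeffℤ p (+ length p ℤ.- + k))

  -- y ∈ K_∞ is the image of the fraction x ∈ K  (y · den = num in K_∞)
  _represents_ : K∞ → Frac → Set ℓ
  y represents x = (y *∞ emb (den x)) ≈∞ emb (num x)

  -- Ternary quadratic lattice L = A v₁ ⊕ A v₂ ⊕ A v₃ with K-valued form Q,
  -- described by its (symmetric) Gram matrix m with respect to the basis:
  -- Q(Σ xᵢ vᵢ) = Σᵢⱼ mᵢⱼ xᵢ xⱼ, so that mᵢⱼ = ½ B(vᵢ,vⱼ).

  Gram : Set c
  Gram = Fin 3 → Fin 3 → Frac

  IsGram : Gram → Set ℓ
  IsGram m = (∀ i j → IsK (m i j)) × (∀ i j → m i j ≈K m j i)

  sum3K : (Fin 3 → Frac) → Frac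
  sum3K f = f Fin.zero +K (f (Fin.suc Fin.zero) +K f (Fin.suc (Fin.suc Fin.zero)))

  Vec3 : Set c
  Vec3 = Fin 3 → Poly

  QL : Gram → Vec3 → Frac
  QL m x = sum3K (λ i → sum3K (λ j → (m i j *K ι (x i)) *K ι (x j)))

  BL : Gram → Vec3 → Vec3 → Frac
  BL m x y = (QL m (λ i → x i +ₚ y i) +K (-K QL m x)) +K (-K QL m y)

  -- definite: Q is anisotropic over K_∞
  sum3∞ : (Fin 3 → K∞) → K∞
  sum3∞ f = f Fin.zero +∞ (f (Fin.suc Fin.zero) +∞ f (Fin.suc (Fin.suc Fin.zero)))

  Definite : Gram → Set (c ⊔ ℓ)
  Definite m =
    (y : Fin 3 → Fin 3 → K∞) → (∀ i j → y i j represents m i j) →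
    (x : Fin 3 → K∞) →
    sum3∞ (λ i → sum3∞ (λ j → (y i j *∞ x i) *∞ x j)) ≈∞ 0∞ →
    ∀ i → x i ≈∞ 0∞

  Reduced : Gram → Set
  Reduced m =
    (∀ i j → i Fin.≤ j → degK (m i i) ≤ᵈ degK (m j j)) ×
    (∀ i j → i Fin.< j → degK (m i j) <ᵈ degK (m i i))

  inM : Poly → Poly → Vec3
  inM a b Fin.zero                   = a
  inM a b (Fin.suc Fin.zero)         = b
  inM a b (Fin.suc (Fin.suc Fin.zero)) = 0ₚ

  v₃ : Vec3
  v₃ Fin.zero                   = 0ₚ
  v₃ (Fin.suc Fin.zero)         = 0ₚ
  v₃ (Fin.suc (Fin.suc Fin.zero)) = 1ₚ

-- Everything is computed in K∞ = F_q((1/t)), where an element of K is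
-- represented by a Laurent series and deg is the valuation at infinity.
-- With Yᵢⱼ the series of the Gram entries and w = a v₁ + b v₂,
--   Q(w) = Y₀₀a² + Y₁₁b² + (Y₀₁ + Y₁₀)ab,   B(w, v₃) = (Y₀₂ + Y₂₀)a + (Y₁₂ + Y₂₁)b.
-- Reducedness gives deg Yᵢⱼ < deg Yᵢᵢ for i < j and deg Y₀₀ ≤ deg Y₁₁, so the
-- cross term and B(w, v₃) have degree below E = max(deg Y₀₀a², deg Y₁₁b²).
-- The two leading terms cannot cancel in degree E: otherwise the discriminant
-- Y₀₁² − Y₀₀Y₁₁ would have a nonzero square leading coefficient in even degree,
-- hence (q odd, Hensel's lemma) be a square s², and (s − Y₀₁, Y₀₀, 0) would be
-- an isotropic vector of the definite form. Hence deg Q(w) = E > deg B(w, v₃).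

module Submission where

open import Defs
open import Level using (Level; _⊔_)
open import Algebra.Bundles using (CommutativeRing)
open import Algebra.Structures using (IsCommutativeRing)
open import Data.Nat as ℕ using (ℕ; zero; suc; _∸_; z≤n; s≤s; _%_)
  renaming (_+_ to _+ₙ_; _≤_ to _≤ₙ_; _<_ to _<ₙ_)
import Data.Nat.Properties as ℕP
open import Data.Integer as ℤ using (ℤ; +_; -[1+_])
import Data.Integer.Properties as ℤP
import Data.Integer.Tactic.RingSolver as ℤ-Solver
open import Data.Fin as Fin using (Fin)
open import Data.Product using (Σ; _×_; _,_; proj₁; proj₂)
open import Data.Sum using (_⊎_; inj₁; inj₂)
open import Data.Empty using (⊥; ⊥-elim)
open import Data.Maybe using (Maybe; just; nothing)
open import Data.List using (List; []; _∷_; map; length)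
open import Relation.Nullary using (¬_; yes; no)
open import Relation.Binary.PropositionalEquality as ≡ using (_≡_; _≢_)
open import Relation.Binary.Definitions using (Tri; tri<; tri≈; tri>)

module IntegerCoefficientSolver {a b : Level} (R : CommutativeRing a b) where
  -- The ring solver for an arbitrary commutative ring, with ℤ as coefficient ring
  -- so that normal forms are compared by computation.
  open CommutativeRing R
  open import Algebra.Properties.Ring ring using (-‿distribˡ-*; -‿distribʳ-*; -‿involutive; -0#≈0#)
  open import Algebra.Properties.AbelianGroup +-abelianGroup using (⁻¹-∙-comm)
  open import Algebra.Properties.CommutativeSemigroup *-commutativeSemigroup using () renaming (interchange to *-interchange)
  open import Algebra.Properties.Semiring.Mult.TCOptimised semiring using (1+×; ×-homo-+; ×1-homo-*) renaming (_×_ to _×′_)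
  import Algebra.Solver.Ring.AlmostCommutativeRing as ACR
  open import Data.Sign as Sign using (Sign)
  open import Relation.Binary.Reasoning.Setoid setoid

  fromℕ : ℕ → Carrier
  fromℕ n = n ×′ 1#

  fromℤ : ℤ → Carrier
  fromℤ (+ n)    = fromℕ n
  fromℤ -[1+ n ] = - fromℕ (suc n)

  fromSign : Sign → Carrier
  fromSign Sign.+ = 1#
  fromSign Sign.- = - 1#

  fromℤ-⊖ : ∀ m n → fromℤ (m ℤ.⊖ n) ≈ fromℕ m - fromℕ n
  fromℤ-⊖ m       zero    = sym (trans (+-congˡ -0#≈0#) (+-identityʳ _))
  fromℤ-⊖ zero    (suc n) = sym (+-identityˡ _)
  fromℤ-⊖ (suc m) (suc n) = begin
    fromℤ (suc m ℤ.⊖ suc n)             ≡⟨ ≡.cong fromℤ (ℤP.[1+m]⊖[1+n]≡m⊖n m n) ⟩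
    fromℤ (m ℤ.⊖ n)                     ≈⟨ fromℤ-⊖ m n ⟩
    fromℕ m - fromℕ n                   ≈⟨ +-identityʳ _ ⟨
    fromℕ m - fromℕ n + 0#              ≈⟨ +-congˡ (-‿inverseʳ 1#) ⟨
    fromℕ m - fromℕ n + (1# - 1#)       ≈⟨ rearrange (fromℕ m) (fromℕ n) 1# (- 1#) ⟩
    (1# + fromℕ m) + (- 1# - fromℕ n)   ≈⟨ +-congˡ (⁻¹-∙-comm 1# (fromℕ n)) ⟩
    (1# + fromℕ m) - (1# + fromℕ n)     ≈⟨ +-cong (1+× m 1#) (-‿cong (1+× n 1#)) ⟨
    fromℕ (suc m) - fromℕ (suc n)       ∎
    where
    rearrange : ∀ x y u v → (x + - y) + (u + v) ≈ (u + x) + (v + - y)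
    rearrange x y u v = begin
      (x + - y) + (u + v)   ≈⟨ +-assoc x (- y) (u + v) ⟩
      x + (- y + (u + v))   ≈⟨ +-congˡ (trans (+-comm _ _) (+-assoc u v (- y))) ⟩
      x + (u + (v + - y))   ≈⟨ sym (+-assoc x u _) ⟩
      (x + u) + (v + - y)   ≈⟨ +-congʳ (+-comm x u) ⟩
      (u + x) + (v + - y)   ∎

  fromℤ-+ : ∀ i j → fromℤ (i ℤ.+ j) ≈ fromℤ i + fromℤ j
  fromℤ-+ (+ m)    (+ n)    = ×-homo-+ 1# m n
  fromℤ-+ (+ m)    -[1+ n ] = fromℤ-⊖ m (suc n)
  fromℤ-+ -[1+ m ] (+ n)    = trans (fromℤ-⊖ n (suc m)) (+-comm _ _)
  fromℤ-+ -[1+ m ] -[1+ n ] = begin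
    - fromℕ (suc (suc (m +ₙ n)))        ≡⟨ ≡.cong (λ k → - fromℕ k) (≡.sym (ℕP.+-suc (suc m) n)) ⟩
    - fromℕ (suc m +ₙ suc n)            ≈⟨ -‿cong (×-homo-+ 1# (suc m) (suc n)) ⟩
    - (fromℕ (suc m) + fromℕ (suc n))   ≈⟨ ⁻¹-∙-comm _ _ ⟨
    - fromℕ (suc m) - fromℕ (suc n)     ∎

  fromℤ-◃ : ∀ s n → fromℤ (s ℤ.◃ n) ≈ fromSign s * fromℕ n
  fromℤ-◃ s       zero    = sym (zeroʳ _)
  fromℤ-◃ Sign.+ (suc n) = sym (*-identityˡ _)
  fromℤ-◃ Sign.- (suc n) = trans (-‿cong (sym (*-identityˡ _))) (-‿distribˡ-* 1# _)

  fromℤ-sign-abs : ∀ i → fromℤ i ≈ fromSign (ℤ.sign i) * fromℕ ℤ.∣ i ∣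
  fromℤ-sign-abs (+ n)    = sym (*-identityˡ _)
  fromℤ-sign-abs -[1+ n ] = trans (-‿cong (sym (*-identityˡ _))) (-‿distribˡ-* 1# _)

  fromSign-* : ∀ s t → fromSign (s Sign.* t) ≈ fromSign s * fromSign t
  fromSign-* Sign.+ t      = sym (*-identityˡ _)
  fromSign-* Sign.- Sign.+ = sym (*-identityʳ _)
  fromSign-* Sign.- Sign.- = begin
    1#              ≈⟨ -‿involutive 1# ⟨
    - - 1#          ≈⟨ -‿cong (*-identityʳ _) ⟨
    - (- 1# * 1#)   ≈⟨ -‿distribʳ-* _ _ ⟩
    - 1# * - 1#     ∎

  fromℤ-* : ∀ i j → fromℤ (i ℤ.* j) ≈ fromℤ i * fromℤ j
  fromℤ-* i j = begin
    fromℤ (i ℤ.* j)                                         ≈⟨ fromℤ-◃ (s Sign.* t) (ℤ.∣ i ∣ ℕ.* ℤ.∣ j ∣) ⟩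
    fromSign (s Sign.* t) * fromℕ (ℤ.∣ i ∣ ℕ.* ℤ.∣ j ∣)     ≈⟨ *-cong (fromSign-* s t) (×1-homo-* ℤ.∣ i ∣ ℤ.∣ j ∣) ⟩
    (fromSign s * fromSign t) * (fromℕ ℤ.∣ i ∣ * fromℕ ℤ.∣ j ∣) ≈⟨ *-interchange _ _ _ _ ⟩
    (fromSign s * fromℕ ℤ.∣ i ∣) * (fromSign t * fromℕ ℤ.∣ j ∣) ≈⟨ *-cong (fromℤ-sign-abs i) (fromℤ-sign-abs j) ⟨
    fromℤ i * fromℤ j                                       ∎
    where
    s = ℤ.sign i
    t = ℤ.sign j

  fromℤ-neg : ∀ i → fromℤ (ℤ.- i) ≈ - fromℤ i
  fromℤ-neg (+ zero)  = sym -0#≈0#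
  fromℤ-neg (+ suc n) = refl
  fromℤ-neg -[1+ n ]  = sym (-‿involutive _)

  fromℤ-homomorphism : ACR._-Raw-AlmostCommutative⟶_ ℤ.+-*-rawRing (ACR.fromCommutativeRing R)
  fromℤ-homomorphism = record
    { ⟦_⟧    = fromℤ
    ; +-homo = fromℤ-+
    ; *-homo = fromℤ-*
    ; -‿homo = fromℤ-neg
    ; 0-homo = refl
    ; 1-homo = refl
    }

  fromℤ-≟ : ∀ i j → Maybe (fromℤ i ≈ fromℤ j)
  fromℤ-≟ i j with i ℤ.≟ j
  ... | yes ≡.refl = just refl
  ... | no _       = nothing

  open import Algebra.Solver.Ring ℤ.+-*-rawRing (ACR.fromCommutativeRing R) fromℤ-homomorphism fromℤ-≟ public

module Parity where
  open import Data.List using (filter; allFin)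
  open import Data.List.Properties using (filter-all; length-tabulate)
  open import Data.List.Membership.Propositional using (_∈_)
  open import Data.List.Membership.Propositional.Properties using (∈-filter⁺; ∈-filter⁻; ∈-allFin)
  open import Data.List.Relation.Unary.Any using (here; there)
  import Data.List.Relation.Unary.All as All
  open import Data.List.Relation.Unary.AllPairs using (_∷_)
  open import Data.List.Relation.Unary.Unique.Propositional using (Unique)
  import Data.List.Relation.Unary.Unique.Propositional.Properties as Unique
  open import Data.Nat.Divisibility using (_∣_; _∣0; ∣m∣n⇒∣m+n; ∣-refl)
  open import Relation.Nullary using (¬?)
  open import Relation.Binary using (DecidableEquality)
  import Data.Fin.Properties as FinP

  module _ {a} {A : Set a} (_≟_ : DecidableEquality A) where

    without : A → List A → List A
    without s = filter (λ y → ¬? (y ≟ s))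

    length-without : ∀ {s} ys → s ∈ ys → Unique ys → suc (length (without s ys)) ≡ length ys
    length-without (y ∷ ys) (here ≡.refl) (y∉ys ∷ _) with y ≟ y
    ... | yes _   = ≡.cong suc (≡.cong length (filter-all _ (All.map (λ y≢z z≡y → y≢z (≡.sym z≡y)) y∉ys)))
    ... | no y≢y = ⊥-elim (y≢y ≡.refl)
    length-without {s} (y ∷ ys) (there s∈ys) (y∉ys ∷ u) with y ≟ s
    ... | yes ≡.refl = ⊥-elim (All.lookup y∉ys s∈ys ≡.refl)
    ... | no _       = ≡.cong suc (length-without ys s∈ys u)

    module _ (σ : A → A) (σ-involutive : ∀ x → σ (σ x) ≡ x) (σ-fixedPointFree : ∀ x → σ x ≢ x) where

      Closed : List A → Set a
      Closed xs = ∀ {x} → x ∈ xs → σ x ∈ xs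

      remove-orbit : ∀ {x ys} → Unique (x ∷ ys) → Closed (x ∷ ys) →
                     Σ (List A) λ zs → suc (length zs) ≡ length ys × Unique zs × Closed zs
      remove-orbit {x} {ys} (x∉ys ∷ ys-unique) closed =
        without (σ x) ys , length-without ys σx∈ys ys-unique , Unique.filter⁺ _ ys-unique , zs-closed
        where
        σx∈ys : σ x ∈ ys
        σx∈ys with closed (here ≡.refl)
        ... | here σx≡x  = ⊥-elim (σ-fixedPointFree x σx≡x)
        ... | there σx∈ = σx∈

        zs-closed : Closed (without (σ x) ys)
        zs-closed z∈zs with ∈-filter⁻ _ z∈zs
        ... | z∈ys , z≢σx with closed (there z∈ys)
        ...   | here σz≡x   = ⊥-elim (z≢σx (≡.trans (≡.sym (σ-involutive _)) (≡.cong σ σz≡x)))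
        ...   | there σz∈ys = ∈-filter⁺ _ σz∈ys σz≢σx
          where
          σz≢σx : σ _ ≢ σ x
          σz≢σx σz≡σx = All.lookup x∉ys z∈ys
            (≡.sym (≡.trans (≡.sym (σ-involutive _)) (≡.trans (≡.cong σ σz≡σx) (σ-involutive x))))

      closed-length-even : ∀ n xs → length xs ≡ n → Unique xs → Closed xs → 2 ∣ n
      closed-length-even zero          _        _   _ _      = 2 ∣0
      closed-length-even (suc zero)    (x ∷ ys) len u closed with remove-orbit u closed
      ... | _ , 1+|zs|≡|ys| , _ = ⊥-elim (ℕP.1+n≢0 (≡.trans 1+|zs|≡|ys| (ℕP.suc-injective len)))
      closed-length-even (suc (suc n)) (x ∷ ys) len u closed with remove-orbit u closed
      ... | zs , 1+|zs|≡|ys| , zs-unique , zs-closed = ∣m∣n⇒∣m+n ∣-refl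
        (closed-length-even n zs (ℕP.suc-injective (≡.trans 1+|zs|≡|ys| (ℕP.suc-injective len))) zs-unique zs-closed)

  fixedPointFreeInvolution⇒2∣ : ∀ {n} (σ : Fin n → Fin n) → (∀ i → σ (σ i) ≡ i) → (∀ i → σ i ≢ i) → 2 ∣ n
  fixedPointFreeInvolution⇒2∣ {n} σ σ-involutive σ-fixedPointFree =
    closed-length-even FinP._≟_ σ σ-involutive σ-fixedPointFree n (allFin n)
      (length-tabulate (λ i → i)) (Unique.allFin⁺ n) (λ {i} _ → ∈-allFin (σ i))

module IntegerArithmetic where
  open ℤ-Solver using (solve-∀)

  m-[m-n]≡n : ∀ m n → m ℤ.- (m ℤ.- n) ≡ n
  m-[m-n]≡n = solve-∀

  exponent-split : ∀ N j → (Σ ℕ λ k → j ≡ + N ℤ.- + k) ⊎ (Σ ℕ λ m → j ≡ + m × N <ₙ m)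
  exponent-split N (+ m) with m ℕ.≤? N
  ... | yes m≤N = inj₁ (N ∸ m , ≡.sym N-[N∸m]≡m)
    where
    N-[N∸m]≡m : + N ℤ.- + (N ∸ m) ≡ + m
    N-[N∸m]≡m = ≡.trans (ℤP.m-n≡m⊖n N (N ∸ m)) (≡.trans (ℤP.⊖-≥ (ℕP.m∸n≤m N m)) (≡.cong +_ (ℕP.m∸[m∸n]≡n m≤N)))
  ... | no m≰N  = inj₂ (m , ≡.refl , ℕP.≰⇒> m≰N)
  exponent-split N -[1+ m ] = inj₁ (N +ₙ suc m , ≡.sym N-[N+1+m]≡-1-m)
    where
    N-[N+1+m]≡-1-m : + N ℤ.- + (N +ₙ suc m) ≡ -[1+ m ]
    N-[N+1+m]≡-1-m = ≡.trans (ℤP.m-n≡m⊖n N (N +ₙ suc m))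
      (≡.trans (ℤP.⊖-< (ℕP.m<m+n N (s≤s z≤n))) (≡.cong (λ x → ℤ.- (+ x)) (ℕP.m+n∸m≡n N (suc m))))

  m-n≡k⇒k+n≡m : ∀ m n k → + k ≡ + m ℤ.- + n → k +ₙ n ≡ m
  m-n≡k⇒k+n≡m m n k e = ℤP.+-injective (≡.trans (ℤP.pos-+ k n) (≡.trans (≡.cong (ℤ._+ + n) e) (cancel (+ m) (+ n))))
    where
    cancel : ∀ a b → (a ℤ.- b) ℤ.+ b ≡ a
    cancel = solve-∀

  a-b≡c-d⇒c+b≡a+d : ∀ a b c d → + a ℤ.- + b ≡ + c ℤ.- + d → c +ₙ b ≡ a +ₙ d
  a-b≡c-d⇒c+b≡a+d a b c d e = ℤP.+-injective (≡.trans (ℤP.pos-+ c b) (≡.trans (rearrange (+ a) (+ b) (+ c) (+ d) e) (≡.sym (ℤP.pos-+ a d))))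
    where
    rearrange : ∀ a b c d → a ℤ.- b ≡ c ℤ.- d → c ℤ.+ b ≡ a ℤ.+ d
    rearrange a b c d e = begin
      c ℤ.+ b                         ≡⟨ split c b d ⟩
      (c ℤ.- d) ℤ.+ (b ℤ.+ d)         ≡⟨ ≡.cong (ℤ._+ (b ℤ.+ d)) e ⟨
      (a ℤ.- b) ℤ.+ (b ℤ.+ d)         ≡⟨ merge a b d ⟩
      a ℤ.+ d                         ∎
      where
      open ≡.≡-Reasoning
      split : ∀ c b d → c ℤ.+ b ≡ (c ℤ.- d) ℤ.+ (b ℤ.+ d)
      split = solve-∀
      merge : ∀ a b d → (a ℤ.- b) ℤ.+ (b ℤ.+ d) ≡ a ℤ.+ d
      merge = solve-∀

  N-i<N-k : ∀ N {i k} → k <ₙ i → + N ℤ.- + i ℤ.< + N ℤ.- + k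
  N-i<N-k N k<i = ℤP.+-monoʳ-< (+ N) (ℤP.neg-mono-< (ℤ.+<+ k<i))

  N-i<N-k⇒k<i : ∀ N {i k} → + N ℤ.- + i ℤ.< + N ℤ.- + k → k <ₙ i
  N-i<N-k⇒k<i N {i} {k} lt with k ℕ.<? i
  ... | yes k<i = k<i
  ... | no k≮i  = ⊥-elim (ℤP.<⇒≱ lt (ℤP.+-monoʳ-≤ (+ N) (ℤP.neg-mono-≤ (ℤ.+≤+ (ℕP.≮⇒≥ k≮i)))))

  i≤+∣i∣ : ∀ i → i ℤ.≤ + ℤ.∣ i ∣
  i≤+∣i∣ (+ n)    = ℤP.≤-refl
  i≤+∣i∣ -[1+ n ] = ℤ.-≤+

  i+i≤j+j⇒i≤j : ∀ {i j} → i ℤ.+ i ℤ.≤ j ℤ.+ j → i ℤ.≤ j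
  i+i≤j+j⇒i≤j {i} {j} i+i≤j+j with ℤP.≤-total i j
  ... | inj₁ i≤j = i≤j
  ... | inj₂ j≤i with j ℤ.≟ i
  ...   | yes ≡.refl = ℤP.≤-refl
  ...   | no j≢i     = ⊥-elim (ℤP.<⇒≱ (ℤP.+-mono-< j<i j<i) i+i≤j+j)
    where j<i = ℤP.≤∧≢⇒< j≤i j≢i

  midpoint : ∀ d₀ d₁ α β → (d₀ ℤ.+ α) ℤ.+ α ≡ (d₁ ℤ.+ β) ℤ.+ β →
             ((d₁ ℤ.+ β) ℤ.- α) ℤ.+ ((d₁ ℤ.+ β) ℤ.- α) ≡ d₀ ℤ.+ d₁
  midpoint d₀ d₁ α β balanced = begin
    ((d₁ ℤ.+ β) ℤ.- α) ℤ.+ ((d₁ ℤ.+ β) ℤ.- α)                      ≡⟨ expand d₀ d₁ α β ⟩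
    (d₀ ℤ.+ d₁) ℤ.+ (((d₁ ℤ.+ β) ℤ.+ β) ℤ.- ((d₀ ℤ.+ α) ℤ.+ α))   ≡⟨ ≡.cong (λ t → (d₀ ℤ.+ d₁) ℤ.+ (t ℤ.- ((d₀ ℤ.+ α) ℤ.+ α))) balanced ⟨
    (d₀ ℤ.+ d₁) ℤ.+ (((d₀ ℤ.+ α) ℤ.+ α) ℤ.- ((d₀ ℤ.+ α) ℤ.+ α))   ≡⟨ cancel (d₀ ℤ.+ d₁) ((d₀ ℤ.+ α) ℤ.+ α) ⟩
    d₀ ℤ.+ d₁                                                     ∎
    where
    open ≡.≡-Reasoning
    expand : ∀ d₀ d₁ α β → ((d₁ ℤ.+ β) ℤ.- α) ℤ.+ ((d₁ ℤ.+ β) ℤ.- α) ≡ (d₀ ℤ.+ d₁) ℤ.+ (((d₁ ℤ.+ β) ℤ.+ β) ℤ.- ((d₀ ℤ.+ α) ℤ.+ α))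
    expand = solve-∀
    cancel : ∀ u t → u ℤ.+ (t ℤ.- t) ≡ u
    cancel = solve-∀

  [i-1]+[i-1]<i+j : ∀ {i j} → i ℤ.≤ j → (i ℤ.- ℤ.1ℤ) ℤ.+ (i ℤ.- ℤ.1ℤ) ℤ.< i ℤ.+ j
  [i-1]+[i-1]<i+j {i} {j} i≤j = ℤP.<-≤-trans (≡.subst₂ ℤ._<_ (≡.sym (regroup i)) (ℤP.+-identityʳ (i ℤ.+ i)) (ℤP.+-monoʳ-< (i ℤ.+ i) ℤ.-<+))
                                             (ℤP.+-monoʳ-≤ i i≤j)
    where
    regroup : ∀ i → (i ℤ.- ℤ.1ℤ) ℤ.+ (i ℤ.- ℤ.1ℤ) ≡ (i ℤ.+ i) ℤ.+ -[1+ 1 ]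
    regroup = solve-∀

  i-1<i : ∀ i → i ℤ.- ℤ.1ℤ ℤ.< i
  i-1<i i = ≡.subst (i ℤ.- ℤ.1ℤ ℤ.<_) (ℤP.+-identityʳ i) (ℤP.+-monoʳ-< i ℤ.-<+)

  [d-1]+α<E : ∀ d α {E} → (d ℤ.+ + α) ℤ.+ + α ℤ.≤ E → (d ℤ.- ℤ.1ℤ) ℤ.+ + α ℤ.< E
  [d-1]+α<E d α d+2α≤E = ℤP.<-≤-trans (≡.subst (ℤ._< d ℤ.+ + α) (≡.sym (regroup d (+ α))) (i-1<i (d ℤ.+ + α)))
                                       (ℤP.≤-trans (ℤP.i≤i+j (d ℤ.+ + α) (+ α)) d+2α≤E)
    where
    regroup : ∀ d a → (d ℤ.- ℤ.1ℤ) ℤ.+ a ≡ (d ℤ.+ a) ℤ.- ℤ.1ℤ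
    regroup = solve-∀

  [d₀-1]+α+β<E : ∀ {d₀ d₁ E} α β → d₀ ℤ.≤ d₁ → (d₀ ℤ.+ + α) ℤ.+ + α ℤ.≤ E → (d₁ ℤ.+ + β) ℤ.+ + β ℤ.≤ E →
                 ((d₀ ℤ.- ℤ.1ℤ) ℤ.+ + α) ℤ.+ + β ℤ.< E
  [d₀-1]+α+β<E {d₀} {d₁} {E} α β d₀≤d₁ d₀+2α≤E d₁+2β≤E =
    ℤP.<-≤-trans (≡.subst (ℤ._< x) (≡.sym (regroup d₀ (+ α) (+ β))) (i-1<i x)) (i+i≤j+j⇒i≤j x+x≤E+E)
    where
    x = (d₀ ℤ.+ + α) ℤ.+ + β
    regroup : ∀ d a b → ((d ℤ.- ℤ.1ℤ) ℤ.+ a) ℤ.+ b ≡ ((d ℤ.+ a) ℤ.+ b) ℤ.- ℤ.1ℤ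
    regroup = solve-∀
    double : ∀ d a b → ((d ℤ.+ a) ℤ.+ b) ℤ.+ ((d ℤ.+ a) ℤ.+ b) ≡ ((d ℤ.+ a) ℤ.+ a) ℤ.+ ((d ℤ.+ b) ℤ.+ b)
    double = solve-∀
    d₀+2β≤E : (d₀ ℤ.+ + β) ℤ.+ + β ℤ.≤ E
    d₀+2β≤E = ℤP.≤-trans (ℤP.+-monoˡ-≤ (+ β) (ℤP.+-monoˡ-≤ (+ β) d₀≤d₁)) d₁+2β≤E
    x+x≤E+E : x ℤ.+ x ℤ.≤ E ℤ.+ E
    x+x≤E+E = ≡.subst (ℤ._≤ E ℤ.+ E) (≡.sym (double d₀ (+ α) (+ β))) (ℤP.+-mono-≤ d₀+2α≤E d₀+2β≤E)

module FieldProperties {c ℓ : Level} (F : FiniteField c ℓ) where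
  open Parity using (fixedPointFreeInvolution⇒2∣)
  open import Data.Nat.Divisibility using (_∣_; n∣m⇒m%n≡0)
  open FiniteField F hiding (zero)
  open import Relation.Binary.Reasoning.Setoid setoid
  open import Algebra.Properties.CommutativeSemigroup *-commutativeSemigroup using () renaming (interchange to *-interchange)
  module FieldSolver = IntegerCoefficientSolver commRing

  *-nonzero : ∀ {x y} → ¬ (x ≈ 0#) → ¬ (y ≈ 0#) → ¬ (x * y ≈ 0#)
  *-nonzero {x} {y} x≉0 y≉0 xy≈0 with inverse x x≉0 | inverse y y≉0
  ... | x⁻¹ , xx⁻¹≈1 | y⁻¹ , yy⁻¹≈1 = 1≉0 (begin
    1#                    ≈⟨ *-identityˡ 1# ⟨
    1# * 1#               ≈⟨ *-cong xx⁻¹≈1 yy⁻¹≈1 ⟨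
    (x * x⁻¹) * (y * y⁻¹) ≈⟨ *-interchange x x⁻¹ y y⁻¹ ⟩
    (x * y) * (x⁻¹ * y⁻¹) ≈⟨ *-congʳ xy≈0 ⟩
    0# * (x⁻¹ * y⁻¹)      ≈⟨ zeroˡ _ ⟩
    0#                    ∎)

  inverse-nonzero : ∀ {x y} → x * y ≈ 1# → ¬ (x ≈ 0#)
  inverse-nonzero {y = y} xy≈1 x≈0 = 1≉0 (trans (sym xy≈1) (trans (*-congʳ x≈0) (zeroˡ y)))

  ratio-square : ∀ {x y a b b⁻¹} → b * b⁻¹ ≈ 1# → (x * a) * a + (y * b) * b ≈ 0# →
                 ((x * a) * b⁻¹) * ((x * a) * b⁻¹) ≈ - (x * y)
  ratio-square {x} {y} {a} {b} {b⁻¹} bb⁻¹≈1 xa²+yb²≈0 = begin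
    ((x * a) * b⁻¹) * ((x * a) * b⁻¹)     ≈⟨ solve 3 (λ x a b⁻¹ → ((x :* a) :* b⁻¹) :* ((x :* a) :* b⁻¹) := ((x :* a) :* a) :* (x :* (b⁻¹ :* b⁻¹))) refl x a b⁻¹ ⟩
    ((x * a) * a) * (x * (b⁻¹ * b⁻¹))     ≈⟨ *-congʳ xa²≈-yb² ⟩
    (- ((y * b) * b)) * (x * (b⁻¹ * b⁻¹)) ≈⟨ solve 4 (λ x b b⁻¹ y → (:- ((y :* b) :* b)) :* (x :* (b⁻¹ :* b⁻¹)) := (:- (x :* y)) :* ((b :* b⁻¹) :* (b :* b⁻¹))) refl x b b⁻¹ y ⟩
    (- (x * y)) * ((b * b⁻¹) * (b * b⁻¹)) ≈⟨ *-congˡ (*-cong bb⁻¹≈1 bb⁻¹≈1) ⟩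
    (- (x * y)) * (1# * 1#)               ≈⟨ solve 1 (λ u → u :* (con (+ 1) :* con (+ 1)) := u) refl (- (x * y)) ⟩
    - (x * y)                             ∎
    where
    open FieldSolver
    xa²≈-yb² : (x * a) * a ≈ - ((y * b) * b)
    xa²≈-yb² = trans (solve 2 (λ u v → u := (u :+ v) :+ (:- v)) refl ((x * a) * a) ((y * b) * b))
      (trans (+-congʳ xa²+yb²≈0) (+-identityˡ _))

  2# : Carrier
  2# = 1# + 1#

  r*x+M+x*r≈y : ∀ {r w M x y} → w * (2# * r) ≈ 1# → x ≈ (y - M) * w → r * x + (M + x * r) ≈ y
  r*x+M+x*r≈y {r} {w} {M} {x} {y} w2r≈1 x≈[y-M]w = begin
    r * x + (M + x * r)               ≈⟨ solve 3 (λ r x M → (r :* x) :+ (M :+ (x :* r)) := M :+ (x :* (r :+ r))) refl r x M ⟩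
    M + x * (r + r)                   ≈⟨ +-congˡ (*-cong x≈[y-M]w r+r≈2r) ⟩
    M + ((y - M) * w) * (2# * r)      ≈⟨ +-congˡ (trans (*-assoc _ _ _) (*-congˡ w2r≈1)) ⟩
    M + (y - M) * 1#                  ≈⟨ +-congˡ (*-identityʳ _) ⟩
    M + (y - M)                       ≈⟨ solve 2 (λ M y → M :+ (y :+ (:- M)) := y) refl M y ⟩
    y                                 ∎
    where
    open FieldSolver
    r+r≈2r : r + r ≈ 2# * r
    r+r≈2r = sym (trans (distribʳ r 1# 1#) (+-cong (*-identityˡ r) (*-identityˡ r)))

  -- If 2 = 0 then x ↦ x + 1 is a fixed-point-free involution of F, so q is even.
  odd-order⇒2#≉0 : q % 2 ≡ 1 → ¬ (2# ≈ 0#)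
  odd-order⇒2#≉0 q-odd 2≈0 = ℕP.0≢1+n (≡.trans (≡.sym (n∣m⇒m%n≡0 q 2 2∣q)) q-odd)
    where
    σ : Fin q → Fin q
    σ i = proj₁ (enum-surj (enum i + 1#))
    enum-σ : ∀ i → enum (σ i) ≈ enum i + 1#
    enum-σ i = proj₂ (enum-surj (enum i + 1#))
    σ-involutive : ∀ i → σ (σ i) ≡ i
    σ-involutive i = enum-inj _ _ (begin
      enum (σ (σ i))        ≈⟨ enum-σ (σ i) ⟩
      enum (σ i) + 1#       ≈⟨ +-congʳ (enum-σ i) ⟩
      (enum i + 1#) + 1#    ≈⟨ +-assoc _ _ _ ⟩
      enum i + 2#           ≈⟨ +-congˡ 2≈0 ⟩
      enum i + 0#           ≈⟨ +-identityʳ _ ⟩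
      enum i                ∎)
    σ-fixedPointFree : ∀ i → σ i ≢ i
    σ-fixedPointFree i σi≡i = 1≉0 (begin
      1#                           ≈⟨ solve 2 (λ x o → o := (:- x) :+ (x :+ o)) refl (enum i) 1# ⟩
      - enum i + (enum i + 1#)     ≈⟨ +-congˡ (enum-σ i) ⟨
      - enum i + enum (σ i)        ≡⟨ ≡.cong (λ j → - enum i + enum j) σi≡i ⟩
      - enum i + enum i            ≈⟨ -‿inverseˡ _ ⟩
      0#                           ∎)
      where open FieldSolver
    2∣q : 2 ∣ q
    2∣q = fixedPointFreeInvolution⇒2∣ σ σ-involutive σ-fixedPointFree

module FiniteSums {c ℓ : Level} (F : FiniteField c ℓ) where
  open FiniteField F hiding (zero)
  open Over F
  open import Relation.Binary.Reasoning.Setoid setoid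
  open FieldProperties F using (module FieldSolver)

  sumTo-cong : ∀ n {f g : ℕ → Carrier} → (∀ i → i ≤ₙ n → f i ≈ g i) → sumTo n f ≈ sumTo n g
  sumTo-cong zero    f≈g = f≈g 0 z≤n
  sumTo-cong (suc n) f≈g = +-cong (sumTo-cong n (λ i i≤n → f≈g i (ℕP.m≤n⇒m≤1+n i≤n))) (f≈g (suc n) ℕP.≤-refl)

  sumTo-zero : ∀ n {f : ℕ → Carrier} → (∀ i → i ≤ₙ n → f i ≈ 0#) → sumTo n f ≈ 0#
  sumTo-zero zero    f≈0 = f≈0 0 z≤n
  sumTo-zero (suc n) f≈0 =
    trans (+-cong (sumTo-zero n (λ i i≤n → f≈0 i (ℕP.m≤n⇒m≤1+n i≤n))) (f≈0 (suc n) ℕP.≤-refl)) (+-identityˡ 0#)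

  sumTo-+ : ∀ n (f g : ℕ → Carrier) → sumTo n (λ i → f i + g i) ≈ sumTo n f + sumTo n g
  sumTo-+ zero    f g = refl
  sumTo-+ (suc n) f g = trans (+-congʳ (sumTo-+ n f g))
    (solve 4 (λ a b c d → (a :+ b) :+ (c :+ d) := (a :+ c) :+ (b :+ d)) refl (sumTo n f) (sumTo n g) (f (suc n)) (g (suc n)))
    where open FieldSolver

  sumTo-*ˡ : ∀ n a (f : ℕ → Carrier) → a * sumTo n f ≈ sumTo n (λ i → a * f i)
  sumTo-*ˡ zero    a f = refl
  sumTo-*ˡ (suc n) a f = trans (distribˡ a _ _) (+-congʳ (sumTo-*ˡ n a f))

  sumTo-*ʳ : ∀ n a (f : ℕ → Carrier) → sumTo n f * a ≈ sumTo n (λ i → f i * a)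
  sumTo-*ʳ zero    a f = refl
  sumTo-*ʳ (suc n) a f = trans (distribʳ a _ _) (+-congʳ (sumTo-*ʳ n a f))

  sumTo-head : ∀ n (f : ℕ → Carrier) → sumTo (suc n) f ≈ f 0 + sumTo n (λ i → f (suc i))
  sumTo-head zero    f = refl
  sumTo-head (suc n) f = trans (+-congʳ (sumTo-head n f)) (+-assoc _ _ _)

  sumTo-single : ∀ n k (f : ℕ → Carrier) → k ≤ₙ n → (∀ i → i ≤ₙ n → i ≢ k → f i ≈ 0#) → sumTo n f ≈ f k
  sumTo-single zero    .zero f z≤n f≈0 = refl
  sumTo-single (suc n) k     f k≤1+n f≈0 with k ℕ.≟ suc n
  ... | yes ≡.refl = trans (+-congʳ (sumTo-zero n (λ i i≤n → f≈0 i (ℕP.m≤n⇒m≤1+n i≤n) (λ { ≡.refl → ℕP.1+n≰n i≤n }))))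
                           (+-identityˡ _)
  ... | no k≢1+n   = trans (+-cong (sumTo-single n k f (ℕP.≤-pred (ℕP.≤∧≢⇒< k≤1+n k≢1+n)) (λ i i≤n → f≈0 i (ℕP.m≤n⇒m≤1+n i≤n)))
                                   (f≈0 (suc n) ℕP.≤-refl (λ e → k≢1+n (≡.sym e))))
                           (+-identityʳ _)

  sumTo-reverse : ∀ n (f : ℕ → Carrier) → sumTo n f ≈ sumTo n (λ i → f (n ∸ i))
  sumTo-reverse zero    f = refl
  sumTo-reverse (suc n) f = begin
    sumTo n f + f (suc n)                           ≈⟨ +-congʳ (sumTo-reverse n f) ⟩
    sumTo n (λ i → f (n ∸ i)) + f (suc n)           ≈⟨ +-comm _ _ ⟩
    f (suc n) + sumTo n (λ i → f (suc n ∸ suc i))   ≈⟨ sumTo-head n (λ i → f (suc n ∸ i)) ⟨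
    sumTo (suc n) (λ i → f (suc n ∸ i))             ∎

  sumTo-triangle : ∀ n (G : ℕ → ℕ → Carrier) →
    sumTo n (λ k → sumTo k (λ i → G i k)) ≈ sumTo n (λ i → sumTo (n ∸ i) (λ j → G i (i +ₙ j)))
  sumTo-triangle zero    G = refl
  sumTo-triangle (suc n) G = begin
    sumTo n (λ k → sumTo k (λ i → G i k)) + sumTo (suc n) (λ i → G i (suc n))
      ≈⟨ +-congʳ (sumTo-triangle n G) ⟩
    sumTo n (λ i → sumTo (n ∸ i) (λ j → G i (i +ₙ j))) + (sumTo n (λ i → G i (suc n)) + G (suc n) (suc n))
      ≈⟨ +-assoc _ _ _ ⟨
    (sumTo n (λ i → sumTo (n ∸ i) (λ j → G i (i +ₙ j))) + sumTo n (λ i → G i (suc n))) + G (suc n) (suc n)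
      ≈⟨ +-cong (sym (sumTo-+ n _ _)) (reflexive (≡.cong (G (suc n)) (≡.sym (ℕP.+-identityʳ (suc n))))) ⟩
    sumTo n (λ i → sumTo (n ∸ i) (λ j → G i (i +ₙ j)) + G i (suc n)) + G (suc n) (suc n +ₙ 0)
      ≈⟨ +-cong (sumTo-cong n extend-row) (reflexive (≡.cong (λ m → sumTo m (λ j → G (suc n) (suc n +ₙ j))) (≡.sym (ℕP.n∸n≡0 n)))) ⟩
    sumTo (suc n) (λ i → sumTo (suc n ∸ i) (λ j → G i (i +ₙ j))) ∎
    where
    extend-row : ∀ i → i ≤ₙ n → sumTo (n ∸ i) (λ j → G i (i +ₙ j)) + G i (suc n) ≈ sumTo (suc n ∸ i) (λ j → G i (i +ₙ j))
    extend-row i i≤n rewrite ℕP.+-∸-assoc 1 i≤n =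
      +-congˡ (reflexive (≡.cong (G i) (≡.trans (≡.cong suc (≡.sym (ℕP.m+[n∸m]≡n i≤n))) (≡.sym (ℕP.+-suc i (n ∸ i))))))

module PowerSeries {c ℓ : Level} (F : FiniteField c ℓ) where
  open FiniteField F hiding (zero)
  open Over F
  open FiniteSums F
  open FieldProperties F using (*-nonzero; 2#; r*x+M+x*r≈y; module FieldSolver)
  open import Relation.Binary.Reasoning.Setoid setoid
  open import Algebra.Properties.Ring ring using (-0#≈0#)

  Series : Set c
  Series = ℕ → Carrier

  infix  4 _≋_
  infixl 6 _⊞_
  infixl 7 _⋆_

  _≋_ : Series → Series → Set ℓ
  f ≋ g = ∀ k → f k ≈ g k

  _⊞_ : Series → Series → Series
  (f ⊞ g) k = f k + g k

  ⊟_ : Series → Series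
  (⊟ f) k = - f k

  𝟘 : Series
  𝟘 _ = 0#

  𝟙 : Series
  𝟙 zero    = 1#
  𝟙 (suc _) = 0#

  _⋆_ : Series → Series → Series
  (f ⋆ g) k = sumTo k (λ i → f i * g (k ∸ i))

  ⋆-cong : ∀ {f f′ g g′} → f ≋ f′ → g ≋ g′ → f ⋆ g ≋ f′ ⋆ g′
  ⋆-cong f≋f′ g≋g′ k = sumTo-cong k (λ i _ → *-cong (f≋f′ i) (g≋g′ (k ∸ i)))

  ⋆-congˡ : ∀ {f g g′} → g ≋ g′ → f ⋆ g ≋ f ⋆ g′
  ⋆-congˡ {f} = ⋆-cong {f} {f} (λ _ → refl)

  ⋆-congʳ : ∀ {f f′ g} → f ≋ f′ → f ⋆ g ≋ f′ ⋆ g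
  ⋆-congʳ {g = g} f≋f′ = ⋆-cong {g = g} {g} f≋f′ (λ _ → refl)

  ⋆-comm : ∀ f g → f ⋆ g ≋ g ⋆ f
  ⋆-comm f g k = begin
    sumTo k (λ i → f i * g (k ∸ i))               ≈⟨ sumTo-reverse k _ ⟩
    sumTo k (λ i → f (k ∸ i) * g (k ∸ (k ∸ i)))   ≈⟨ sumTo-cong k (λ i i≤k → trans (*-comm _ _) (*-congʳ (reflexive (≡.cong g (ℕP.m∸[m∸n]≡n i≤k))))) ⟩
    sumTo k (λ i → g i * f (k ∸ i))               ∎

  ⋆-identityˡ : ∀ g → 𝟙 ⋆ g ≋ g
  ⋆-identityˡ g k = trans (sumTo-single k 0 _ z≤n vanish) (*-identityˡ _)
    where
    vanish : ∀ i → i ≤ₙ k → i ≢ 0 → 𝟙 i * g (k ∸ i) ≈ 0#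
    vanish zero    _ i≢0 = ⊥-elim (i≢0 ≡.refl)
    vanish (suc i) _ _   = zeroˡ _

  ⋆-distribˡ : ∀ f g h → f ⋆ (g ⊞ h) ≋ f ⋆ g ⊞ f ⋆ h
  ⋆-distribˡ f g h k = trans (sumTo-cong k (λ i _ → distribˡ _ _ _)) (sumTo-+ k _ _)

  ⋆-assoc : ∀ f g h → (f ⋆ g) ⋆ h ≋ f ⋆ (g ⋆ h)
  ⋆-assoc f g h n = begin
    sumTo n (λ k → sumTo k (λ i → f i * g (k ∸ i)) * h (n ∸ k))
      ≈⟨ sumTo-cong n (λ k _ → sumTo-*ʳ k _ _) ⟩
    sumTo n (λ k → sumTo k (λ i → f i * g (k ∸ i) * h (n ∸ k)))
      ≈⟨ sumTo-triangle n (λ i k → f i * g (k ∸ i) * h (n ∸ k)) ⟩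
    sumTo n (λ i → sumTo (n ∸ i) (λ j → f i * g ((i +ₙ j) ∸ i) * h (n ∸ (i +ₙ j))))
      ≈⟨ sumTo-cong n (λ i _ → sumTo-cong (n ∸ i) (λ j _ → trans (*-assoc _ _ _)
           (*-congˡ (*-cong (reflexive (≡.cong g (ℕP.m+n∸m≡n i j)))
                            (reflexive (≡.cong h (≡.sym (ℕP.∸-+-assoc n i j)))))))) ⟩
    sumTo n (λ i → sumTo (n ∸ i) (λ j → f i * (g j * h ((n ∸ i) ∸ j))))
      ≈⟨ sumTo-cong n (λ i _ → sym (sumTo-*ˡ (n ∸ i) _ _)) ⟩
    sumTo n (λ i → f i * sumTo (n ∸ i) (λ j → g j * h ((n ∸ i) ∸ j))) ∎

  ⋆-isCommutativeRing : IsCommutativeRing _≋_ _⊞_ _⋆_ ⊟_ 𝟘 𝟙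
  ⋆-isCommutativeRing = record
    { isRing = record
      { +-isAbelianGroup = record
        { isGroup = record
          { isMonoid = record
            { isSemigroup = record
              { isMagma = record
                { isEquivalence = record
                  { refl  = λ _ → refl
                  ; sym   = λ f≋g k → sym (f≋g k)
                  ; trans = λ f≋g g≋h k → trans (f≋g k) (g≋h k)
                  }
                ; ∙-cong = λ f≋f′ g≋g′ k → +-cong (f≋f′ k) (g≋g′ k)
                }
              ; assoc = λ _ _ _ k → +-assoc _ _ _
              }
            ; identity = (λ _ k → +-identityˡ _) , (λ _ k → +-identityʳ _)
            }
          ; inverse = (λ _ k → -‿inverseˡ _) , (λ _ k → -‿inverseʳ _)
          ; ⁻¹-cong = λ f≋g k → -‿cong (f≋g k)
          }
        ; comm = λ _ _ k → +-comm _ _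
        }
      ; *-cong     = ⋆-cong
      ; *-assoc    = ⋆-assoc
      ; *-identity = ⋆-identityˡ , (λ g k → trans (⋆-comm g 𝟙 k) (⋆-identityˡ g k))
      ; distrib    = ⋆-distribˡ
                   , (λ f g h k → trans (⋆-comm (g ⊞ h) f k)
                       (trans (⋆-distribˡ f g h k) (+-cong (⋆-comm f g k) (⋆-comm f h k))))
      }
    ; *-comm = ⋆-comm
    }

  seriesRing : CommutativeRing c ℓ
  seriesRing = record { isCommutativeRing = ⋆-isCommutativeRing }

  ⋆-interchange : ∀ f g h k → (f ⋆ g) ⋆ (h ⋆ k) ≋ (f ⋆ h) ⋆ (g ⋆ k)
  ⋆-interchange = interchange
    where open import Algebra.Properties.CommutativeSemigroup (CommutativeRing.*-commutativeSemigroup seriesRing)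

  -- u stands for 1/t: Laurent series in t are shifted power series in u.
  u : Series
  u zero          = 0#
  u (suc zero)    = 1#
  u (suc (suc _)) = 0#

  u^ : ℕ → Series
  u^ zero    = 𝟙
  u^ (suc m) = u ⋆ u^ m

  u⋆-zero : ∀ f → (u ⋆ f) 0 ≈ 0#
  u⋆-zero f = zeroˡ _

  u⋆-suc : ∀ f k → (u ⋆ f) (suc k) ≈ f k
  u⋆-suc f k = trans (sumTo-single (suc k) 1 _ (s≤s z≤n) vanish) (*-identityˡ _)
    where
    vanish : ∀ i → i ≤ₙ suc k → i ≢ 1 → u i * f (suc k ∸ i) ≈ 0#
    vanish zero          _ _   = zeroˡ _
    vanish (suc zero)    _ i≢1 = ⊥-elim (i≢1 ≡.refl)
    vanish (suc (suc i)) _ _   = zeroˡ _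

  u^⋆-low : ∀ m f k → k <ₙ m → (u^ m ⋆ f) k ≈ 0#
  u^⋆-low (suc m) f zero    _         = trans (⋆-assoc u (u^ m) f 0) (u⋆-zero (u^ m ⋆ f))
  u^⋆-low (suc m) f (suc k) (s≤s k<m) =
    trans (⋆-assoc u (u^ m) f (suc k)) (trans (u⋆-suc (u^ m ⋆ f) k) (u^⋆-low m f k k<m))

  u^⋆-shift : ∀ m f k → (u^ m ⋆ f) (m +ₙ k) ≈ f k
  u^⋆-shift zero    f k = ⋆-identityˡ f k
  u^⋆-shift (suc m) f k =
    trans (⋆-assoc u (u^ m) f (suc (m +ₙ k))) (trans (u⋆-suc (u^ m ⋆ f) (m +ₙ k)) (u^⋆-shift m f k))

  u^-+ : ∀ m n → u^ (m +ₙ n) ≋ u^ m ⋆ u^ n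
  u^-+ zero    n k = sym (⋆-identityˡ (u^ n) k)
  u^-+ (suc m) n k = trans (⋆-congˡ {u} (u^-+ m n) k) (sym (⋆-assoc u (u^ m) (u^ n) k))

  u^-⋆-u^ : ∀ m n h → u^ m ⋆ (u^ n ⋆ h) ≋ u^ (m +ₙ n) ⋆ h
  u^-⋆-u^ m n h k = trans (sym (⋆-assoc (u^ m) (u^ n) h k)) (⋆-congʳ {g = h} (λ k → sym (u^-+ m n k)) k)

  factor-u^ : ∀ m (g : Series) → (∀ k → k <ₙ m → g k ≈ 0#) → g ≋ u^ m ⋆ (λ k → g (m +ₙ k))
  factor-u^ m g low≈0 k with k ℕ.<? m
  ... | yes k<m = trans (low≈0 k k<m) (sym (u^⋆-low m (λ k → g (m +ₙ k)) k k<m))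
  ... | no k≮m  = begin
    g k                                        ≡⟨ ≡.cong g (≡.sym m+[k∸m]≡k) ⟩
    g (m +ₙ (k ∸ m))                           ≈⟨ u^⋆-shift m (λ k → g (m +ₙ k)) (k ∸ m) ⟨
    (u^ m ⋆ (λ k → g (m +ₙ k))) (m +ₙ (k ∸ m)) ≡⟨ ≡.cong (u^ m ⋆ (λ k → g (m +ₙ k))) m+[k∸m]≡k ⟩
    (u^ m ⋆ (λ k → g (m +ₙ k))) k              ∎
    where
    m+[k∸m]≡k : m +ₙ (k ∸ m) ≡ k
    m+[k∸m]≡k = ℕP.m+[n∸m]≡n (ℕP.≮⇒≥ k≮m)

  module CourseOfValues (step : ℕ → (ℕ → Carrier) → Carrier)
                        (step-cong : ∀ n f g → (∀ i → i <ₙ n → f i ≈ g i) → step n f ≈ step n g) where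

    approx : ℕ → ℕ → Carrier
    approx zero    i = step 0 (λ _ → 0#)
    approx (suc n) i with i ℕ.≤? n
    ... | yes _ = approx n i
    ... | no _  = step (suc n) (approx n)

    fix : ℕ → Carrier
    fix n = approx n n

    approx-stable : ∀ n i → i ≤ₙ n → approx n i ≡ fix i
    approx-stable zero    .zero z≤n = ≡.refl
    approx-stable (suc n) i     i≤1+n with i ℕ.≤? n
    ... | yes i≤n = approx-stable n i i≤n
    ... | no i≰n with ℕP.≤-antisym i≤1+n (ℕP.≰⇒> i≰n)
    ...   | ≡.refl with suc n ℕ.≤? n
    ...     | yes 1+n≤n = ⊥-elim (i≰n 1+n≤n)
    ...     | no _       = ≡.refl

    fix-unfold : ∀ n → fix n ≈ step n fix
    fix-unfold zero = step-cong 0 _ _ (λ i ())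
    fix-unfold (suc n) with suc n ℕ.≤? n
    ... | yes 1+n≤n = ⊥-elim (ℕP.1+n≰n 1+n≤n)
    ... | no _      = step-cong (suc n) _ _ (λ i i<1+n → reflexive (approx-stable n i (ℕP.≤-pred i<1+n)))

  -- Inverting h term by term: the coefficient of uⁿ⁺¹ in f ⋆ h forces that of f.
  ⋆-inverse : ∀ (h : Series) → ¬ (h 0 ≈ 0#) → Σ Series λ f → f ⋆ h ≋ 𝟙
  ⋆-inverse h h₀≉0 = fix , fix⋆h≋𝟙
    where
    h₀⁻¹ = proj₁ (inverse (h 0) h₀≉0)
    h₀h₀⁻¹≈1 = proj₂ (inverse (h 0) h₀≉0)
    step : ℕ → (ℕ → Carrier) → Carrier
    step zero    f = h₀⁻¹
    step (suc n) f = - (h₀⁻¹ * sumTo n (λ i → f i * h (suc n ∸ i)))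
    step-cong : ∀ n f g → (∀ i → i <ₙ n → f i ≈ g i) → step n f ≈ step n g
    step-cong zero    f g _   = refl
    step-cong (suc n) f g f≈g = -‿cong (*-congˡ (sumTo-cong n (λ i i≤n → *-congʳ (f≈g i (s≤s i≤n)))))
    open CourseOfValues step step-cong
    fix⋆h≋𝟙 : fix ⋆ h ≋ 𝟙
    fix⋆h≋𝟙 zero    = trans (*-congʳ (fix-unfold 0)) (trans (*-comm _ _) h₀h₀⁻¹≈1)
    fix⋆h≋𝟙 (suc n) = begin
      (fix ⋆ h) (suc n)          ≈⟨ +-congˡ (*-congˡ (reflexive (≡.cong h (ℕP.n∸n≡0 n)))) ⟩
      S + fix (suc n) * h 0      ≈⟨ +-congˡ (*-congʳ (fix-unfold (suc n))) ⟩
      S + (- (h₀⁻¹ * S)) * h 0   ≈⟨ solve 3 (λ s a b → s :+ (:- (a :* s)) :* b := s :+ (:- (s :* (b :* a)))) refl S h₀⁻¹ (h 0) ⟩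
      S + (- (S * (h 0 * h₀⁻¹))) ≈⟨ +-congˡ (-‿cong (trans (*-congˡ h₀h₀⁻¹≈1) (*-identityʳ S))) ⟩
      S + (- S)                  ≈⟨ -‿inverseʳ S ⟩
      0#                         ∎
      where
      S = sumTo n (λ i → fix i * h (suc n ∸ i))
      open FieldSolver

  -- Square roots term by term: for n ≥ 1 the coefficient of uⁿ in s ⋆ s is
  -- 2 r sₙ plus a polynomial in s₁ … sₙ₋₁, which is where 2 ≠ 0 is needed.
  ⋆-sqrt : ∀ (g : Series) r → g 0 ≈ r * r → ¬ (r ≈ 0#) → ¬ (2# ≈ 0#) → Σ Series λ s → s ⋆ s ≋ g
  ⋆-sqrt g r g₀≈r² r≉0 2≉0 = fix , fix⋆fix≋g
    where
    [2r]⁻¹ = proj₁ (inverse (2# * r) (*-nonzero 2≉0 r≉0))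
    2r[2r]⁻¹≈1 = proj₂ (inverse (2# * r) (*-nonzero 2≉0 r≉0))
    step : ℕ → (ℕ → Carrier) → Carrier
    step zero          f = r
    step (suc zero)    f = g 1 * [2r]⁻¹
    step (suc (suc m)) f = (g (suc (suc m)) - sumTo m (λ i → f (suc i) * f (suc m ∸ i))) * [2r]⁻¹
    step-cong : ∀ n f h → (∀ i → i <ₙ n → f i ≈ h i) → step n f ≈ step n h
    step-cong zero          f h _   = refl
    step-cong (suc zero)    f h _   = refl
    step-cong (suc (suc m)) f h f≈h = *-congʳ (+-congˡ (-‿cong (sumTo-cong m (λ i i≤m →
      *-cong (f≈h (suc i) (s≤s (s≤s i≤m))) (f≈h (suc m ∸ i) (s≤s (ℕP.m∸n≤m (suc m) i)))))))
    open CourseOfValues step step-cong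
    [2r]⁻¹2r≈1 : [2r]⁻¹ * (2# * r) ≈ 1#
    [2r]⁻¹2r≈1 = trans (*-comm _ _) 2r[2r]⁻¹≈1
    fix⋆fix≋g : fix ⋆ fix ≋ g
    fix⋆fix≋g zero          = trans (*-cong (fix-unfold 0) (fix-unfold 0)) (sym g₀≈r²)
    fix⋆fix≋g (suc zero)    = begin
      fix 0 * fix 1 + fix 1 * fix 0   ≈⟨ +-cong (*-congʳ (fix-unfold 0)) (*-congˡ (fix-unfold 0)) ⟩
      r * fix 1 + fix 1 * r           ≈⟨ +-congˡ (+-identityˡ _) ⟨
      r * fix 1 + (0# + fix 1 * r)    ≈⟨ r*x+M+x*r≈y [2r]⁻¹2r≈1 (trans (fix-unfold 1) (*-congʳ (sym (trans (+-congˡ -0#≈0#) (+-identityʳ _))))) ⟩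
      g 1                             ∎
    fix⋆fix≋g (suc (suc m)) = begin
      (fix ⋆ fix) (suc (suc m))
        ≈⟨ sumTo-head (suc m) (λ i → fix i * fix (suc (suc m) ∸ i)) ⟩
      fix 0 * fix (suc (suc m)) + (Mid + fix (suc (suc m)) * fix (m ∸ m))
        ≈⟨ +-congˡ (+-congˡ (*-congˡ (reflexive (≡.cong fix (ℕP.n∸n≡0 m))))) ⟩
      fix 0 * fix (suc (suc m)) + (Mid + fix (suc (suc m)) * fix 0)
        ≈⟨ +-cong (*-congʳ (fix-unfold 0)) (+-congˡ (*-congˡ (fix-unfold 0))) ⟩
      r * fix (suc (suc m)) + (Mid + fix (suc (suc m)) * r)
        ≈⟨ r*x+M+x*r≈y [2r]⁻¹2r≈1 (fix-unfold (suc (suc m))) ⟩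
      g (suc (suc m)) ∎
      where
      Mid = sumTo m (λ i → fix (suc i) * fix (suc m ∸ i))

module LaurentSeries {c ℓ : Level} (F : FiniteField c ℓ) where
  open FiniteField F hiding (zero)
  open Over F
  open PowerSeries F
  open IntegerArithmetic
  open import Relation.Binary.Reasoning.Setoid setoid
  open import Algebra.Properties.Ring ring using (-0#≈0#)
  open ℤ-Solver using (solve-∀)

  coef-within : ∀ N f k → coef∞ (laurent N f) (+ N ℤ.- + k) ≈ f k
  coef-within N f k = reflexive (at-offset (+ N ℤ.- + k) (m-[m-n]≡n (+ N) (+ k)))
    where
    at-offset : ∀ j → + N ℤ.- j ≡ + k → coef∞ (laurent N f) j ≡ f k
    at-offset j e with + N ℤ.- j
    at-offset j ≡.refl | .(+ k) = ≡.refl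

  coef-beyond : ∀ N f m → N <ₙ m → coef∞ (laurent N f) (+ m) ≈ 0#
  coef-beyond N f m N<m = vanishes
    where
    N-m≡-[1+m∸1+N] : + N ℤ.- + m ≡ -[1+ m ∸ suc N ]
    N-m≡-[1+m∸1+N] = ≡.trans (ℤP.m-n≡m⊖n N m) (≡.trans (ℤP.⊖-< N<m) (≡.cong (λ x → ℤ.- (+ x)) (ℕP.+-∸-assoc 1 N<m)))
    vanishes : coef∞ (laurent N f) (+ m) ≈ 0#
    vanishes with + N ℤ.- + m | N-m≡-[1+m∸1+N]
    ... | .(-[1+ _ ]) | ≡.refl = refl

  coef-within′ : ∀ N f k {j} → j ≡ + N ℤ.- + k → coef∞ (laurent N f) j ≈ f k
  coef-within′ N f k ≡.refl = coef-within N f k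

  coef-beyond′ : ∀ N f m {j} → j ≡ + m → N <ₙ m → coef∞ (laurent N f) j ≈ 0#
  coef-beyond′ N f m ≡.refl = coef-beyond N f m

  coef-above-top : ∀ x m → K∞.top x <ₙ m → coef∞ x (+ m) ≈ 0#
  coef-above-top (laurent N f) m = coef-beyond N f m

  -∞_ : K∞ → K∞
  -∞ laurent N f = laurent N (λ k → - f k)

  1∞ : K∞
  1∞ = laurent 0 𝟙

  coef-+∞ : ∀ x y j → coef∞ (x +∞ y) j ≈ coef∞ x j + coef∞ y j
  coef-+∞ x y j with exponent-split (ℕ._⊔_ (K∞.top x) (K∞.top y)) j
  ... | inj₁ (k , ≡.refl)          = coef-within (ℕ._⊔_ (K∞.top x) (K∞.top y)) _ k
  ... | inj₂ (m , ≡.refl , top<m) = trans (coef-beyond _ _ m top<m) (sym (trans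
    (+-cong (coef-above-top x m (ℕP.≤-<-trans (ℕP.m≤m⊔n _ _) top<m)) (coef-above-top y m (ℕP.≤-<-trans (ℕP.m≤n⊔m _ _) top<m)))
    (+-identityˡ 0#)))

  coef-neg∞ : ∀ x j → coef∞ (-∞ x) j ≈ - coef∞ x j
  coef-neg∞ (laurent N f) j with + N ℤ.- j
  ... | + n      = refl
  ... | -[1+ n ] = sym -0#≈0#

  coef-0∞ : ∀ j → coef∞ 0∞ j ≈ 0#
  coef-0∞ j with + 0 ℤ.- j
  ... | + n      = refl
  ... | -[1+ n ] = refl

  laurent-cong : ∀ {M M′ f g} → M ≡ M′ → f ≋ g → laurent M f ≈∞ laurent M′ g
  laurent-cong {M} ≡.refl f≋g j with + M ℤ.- j
  ... | + n      = f≋g n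
  ... | -[1+ n ] = refl

  laurent-injective : ∀ N f g → laurent N f ≈∞ laurent N g → f ≋ g
  laurent-injective N f g eq k = trans (sym (coef-within N f k)) (trans (eq (+ N ℤ.- + k)) (coef-within N g k))

  laurent-+∞ : ∀ M f g → (laurent M f +∞ laurent M g) ≈∞ laurent M (f ⊞ g)
  laurent-+∞ M f g j = trans (coef-+∞ (laurent M f) (laurent M g) j) (same-top j)
    where
    same-top : ∀ j → coef∞ (laurent M f) j + coef∞ (laurent M g) j ≈ coef∞ (laurent M (f ⊞ g)) j
    same-top j with + M ℤ.- j
    ... | + n      = refl
    ... | -[1+ n ] = +-identityˡ 0#

  laurent-shift : ∀ N f s → laurent N f ≈∞ laurent (N +ₙ s) (u^ s ⋆ f)
  laurent-shift N f s j with exponent-split N j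
  ... | inj₁ (k , ≡.refl) = trans (coef-within N f k) (sym (trans (coef-within′ (N +ₙ s) _ (s +ₙ k) shifted) (u^⋆-shift s f k)))
    where
    reindex : ∀ a b c → a ℤ.- c ≡ (a ℤ.+ b) ℤ.- (b ℤ.+ c)
    reindex = solve-∀
    shifted : + N ℤ.- + k ≡ + (N +ₙ s) ℤ.- + (s +ₙ k)
    shifted = ≡.trans (reindex (+ N) (+ s) (+ k)) (≡.sym (≡.cong₂ ℤ._-_ (ℤP.pos-+ N s) (ℤP.pos-+ s k)))
  ... | inj₂ (m , ≡.refl , N<m) with exponent-split (N +ₙ s) (+ m)
  ...   | inj₂ (m′ , m≡m′ , N+s<m′) = trans (coef-beyond N f m N<m) (sym (coef-beyond′ _ _ m′ m≡m′ N+s<m′))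
  ...   | inj₁ (k , m≡N+s-k) = trans (coef-beyond N f m N<m) (sym (trans (coef-within′ (N +ₙ s) _ k m≡N+s-k) (u^⋆-low s f k k<s)))
    where
    k<s : k <ₙ s
    k<s = ℕP.+-cancelˡ-< N k s (ℕP.<-≤-trans (ℕP.+-monoˡ-< k N<m) (ℕP.≤-reflexive (m-n≡k⇒k+n≡m (N +ₙ s) k m m≡N+s-k)))

  laurent-pad : ∀ N f M → N ≤ₙ M → laurent N f ≈∞ laurent M (u^ (M ∸ N) ⋆ f)
  laurent-pad N f M N≤M j = trans (laurent-shift N f (M ∸ N) j) (laurent-cong (ℕP.m+[n∸m]≡n N≤M) (λ _ → refl) j)

  -- laurent M (u^ i ⋆ h) is t^(M - i) h(1/t), so only M - i matters.
  laurent-u^-reindex : ∀ M i M′ i′ h → + M ℤ.- + i ≡ + M′ ℤ.- + i′ → laurent M (u^ i ⋆ h) ≈∞ laurent M′ (u^ i′ ⋆ h)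
  laurent-u^-reindex M i M′ i′ h same-degree j = begin
    coef∞ (laurent M (u^ i ⋆ h)) j                   ≈⟨ laurent-shift M _ M′ j ⟩
    coef∞ (laurent (M +ₙ M′) (u^ M′ ⋆ (u^ i ⋆ h))) j  ≈⟨ laurent-cong (ℕP.+-comm M M′) exponents j ⟩
    coef∞ (laurent (M′ +ₙ M) (u^ M ⋆ (u^ i′ ⋆ h))) j  ≈⟨ laurent-shift M′ _ M j ⟨
    coef∞ (laurent M′ (u^ i′ ⋆ h)) j                 ∎
    where
    exponents : u^ M′ ⋆ (u^ i ⋆ h) ≋ u^ M ⋆ (u^ i′ ⋆ h)
    exponents k = trans (u^-⋆-u^ M′ i h k) (trans (⋆-congʳ {g = h} (λ k → reflexive (≡.cong (λ n → u^ n k) (a-b≡c-d⇒c+b≡a+d M i M′ i′ same-degree))) k)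
      (sym (u^-⋆-u^ M i′ h k)))

  infix 4 _≃_
  record _≃_ (x y : K∞) : Set ℓ where
    constructor coefwise
    field coef-≈ : x ≈∞ y
  open _≃_ public

  +∞-cong : ∀ {x x′ y y′} → x ≃ x′ → y ≃ y′ → x +∞ y ≃ x′ +∞ y′
  +∞-cong {x} {x′} {y} {y′} (coefwise x≈x′) (coefwise y≈y′) = coefwise λ j →
    trans (coef-+∞ x y j) (trans (+-cong (x≈x′ j) (y≈y′ j)) (sym (coef-+∞ x′ y′ j)))

  *∞-congʳ : ∀ {x x′} y → x ≃ x′ → x *∞ y ≃ x′ *∞ y
  *∞-congʳ {laurent N f} {laurent N′ f′} (laurent P g) (coefwise x≈x′) = coefwise λ j → begin
    coef∞ (laurent (N +ₙ P) (f ⋆ g)) j                      ≈⟨ laurent-shift (N +ₙ P) (f ⋆ g) N′ j ⟩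
    coef∞ (laurent (N +ₙ P +ₙ N′) (u^ N′ ⋆ (f ⋆ g))) j       ≈⟨ laurent-cong tops same-series j ⟩
    coef∞ (laurent (N′ +ₙ P +ₙ N) (u^ N ⋆ (f′ ⋆ g))) j       ≈⟨ laurent-shift (N′ +ₙ P) (f′ ⋆ g) N j ⟨
    coef∞ (laurent (N′ +ₙ P) (f′ ⋆ g)) j                    ∎
    where
    common-top : u^ N′ ⋆ f ≋ u^ N ⋆ f′
    common-top = laurent-injective (N +ₙ N′) _ _ λ j → begin
      coef∞ (laurent (N +ₙ N′) (u^ N′ ⋆ f)) j   ≈⟨ laurent-shift N f N′ j ⟨
      coef∞ (laurent N f) j                     ≈⟨ x≈x′ j ⟩
      coef∞ (laurent N′ f′) j                   ≈⟨ laurent-shift N′ f′ N j ⟩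
      coef∞ (laurent (N′ +ₙ N) (u^ N ⋆ f′)) j   ≈⟨ laurent-cong (ℕP.+-comm N′ N) (λ _ → refl) j ⟩
      coef∞ (laurent (N +ₙ N′) (u^ N ⋆ f′)) j   ∎
    tops : N +ₙ P +ₙ N′ ≡ N′ +ₙ P +ₙ N
    tops = ≡.trans (ℕP.+-assoc N P N′) (≡.trans (ℕP.+-comm N (P +ₙ N′)) (≡.cong (_+ₙ N) (ℕP.+-comm P N′)))
    same-series : u^ N′ ⋆ (f ⋆ g) ≋ u^ N ⋆ (f′ ⋆ g)
    same-series k = trans (sym (⋆-assoc (u^ N′) f g k)) (trans (⋆-congʳ {g = g} common-top k) (⋆-assoc (u^ N) f′ g k))

  *∞-comm : ∀ x y → x *∞ y ≃ y *∞ x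
  *∞-comm (laurent N f) (laurent P g) = coefwise (laurent-cong (ℕP.+-comm N P) (⋆-comm f g))

  *∞-cong : ∀ {x x′ y y′} → x ≃ x′ → y ≃ y′ → x *∞ y ≃ x′ *∞ y′
  *∞-cong {x} {x′} {y} {y′} x≃x′ y≃y′ = coefwise λ j →
    trans (coef-≈ (*∞-congʳ y x≃x′) j) (trans (coef-≈ (*∞-comm x′ y) j)
      (trans (coef-≈ (*∞-congʳ x′ y≃y′) j) (coef-≈ (*∞-comm y′ x′) j)))

  *∞-assoc : ∀ x y z → (x *∞ y) *∞ z ≃ x *∞ (y *∞ z)
  *∞-assoc (laurent N f) (laurent P g) (laurent Q h) = coefwise (laurent-cong (ℕP.+-assoc N P Q) (⋆-assoc f g h))

  *∞-identityˡ : ∀ x → 1∞ *∞ x ≃ x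
  *∞-identityˡ (laurent N f) = coefwise (laurent-cong ≡.refl (⋆-identityˡ f))

  *∞-distribˡ : ∀ x y z → x *∞ (y +∞ z) ≃ (x *∞ y) +∞ (x *∞ z)
  *∞-distribˡ x@(laurent N f) (laurent P g) (laurent Q h) = coefwise λ j → begin
    coef∞ (x *∞ (laurent P g +∞ laurent Q h)) j                  ≈⟨ coef-≈ (*∞-cong {x} (coefwise (λ _ → refl)) (coefwise padded-sum)) j ⟩
    coef∞ (laurent (N +ₙ M) (f ⋆ (g′ ⊞ h′))) j                   ≈⟨ laurent-cong ≡.refl (⋆-distribˡ f g′ h′) j ⟩
    coef∞ (laurent (N +ₙ M) (f ⋆ g′ ⊞ f ⋆ h′)) j                 ≈⟨ laurent-+∞ (N +ₙ M) (f ⋆ g′) (f ⋆ h′) j ⟨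
    coef∞ ((x *∞ laurent M g′) +∞ (x *∞ laurent M h′)) j         ≈⟨ coef-≈ (+∞-cong (*∞-cong {x} (coefwise (λ _ → refl)) (coefwise (λ j → sym (g-padded j))))
                                                                           (*∞-cong {x} (coefwise (λ _ → refl)) (coefwise (λ j → sym (h-padded j))))) j ⟩
    coef∞ ((x *∞ laurent P g) +∞ (x *∞ laurent Q h)) j           ∎
    where
    M = ℕ._⊔_ P Q
    g′ = u^ (M ∸ P) ⋆ g
    h′ = u^ (M ∸ Q) ⋆ h
    g-padded : laurent P g ≈∞ laurent M g′
    g-padded = laurent-pad P g M (ℕP.m≤m⊔n P Q)
    h-padded : laurent Q h ≈∞ laurent M h′
    h-padded = laurent-pad Q h M (ℕP.m≤n⊔m P Q)
    padded-sum : (laurent P g +∞ laurent Q h) ≈∞ laurent M (g′ ⊞ h′)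
    padded-sum j = trans (coef-≈ (+∞-cong (coefwise g-padded) (coefwise h-padded)) j) (laurent-+∞ M g′ h′ j)

  K∞-isCommutativeRing : IsCommutativeRing _≃_ _+∞_ _*∞_ -∞_ 0∞ 1∞
  K∞-isCommutativeRing = record
    { isRing = record
      { +-isAbelianGroup = record
        { isGroup = record
          { isMonoid = record
            { isSemigroup = record
              { isMagma = record
                { isEquivalence = record
                  { refl  = coefwise λ _ → refl
                  ; sym   = λ x≃y → coefwise λ j → sym (coef-≈ x≃y j)
                  ; trans = λ x≃y y≃z → coefwise λ j → trans (coef-≈ x≃y j) (coef-≈ y≃z j)
                  }
                ; ∙-cong = +∞-cong
                }
              ; assoc = λ x y z → coefwise λ j → begin
                  coef∞ ((x +∞ y) +∞ z) j                 ≈⟨ trans (coef-+∞ (x +∞ y) z j) (+-congʳ (coef-+∞ x y j)) ⟩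
                  (coef∞ x j + coef∞ y j) + coef∞ z j     ≈⟨ +-assoc _ _ _ ⟩
                  coef∞ x j + (coef∞ y j + coef∞ z j)     ≈⟨ trans (coef-+∞ x (y +∞ z) j) (+-congˡ (coef-+∞ y z j)) ⟨
                  coef∞ (x +∞ (y +∞ z)) j                 ∎
              }
            ; identity = (λ x → coefwise λ j → trans (coef-+∞ 0∞ x j) (trans (+-congʳ (coef-0∞ j)) (+-identityˡ _)))
                       , (λ x → coefwise λ j → trans (coef-+∞ x 0∞ j) (trans (+-congˡ (coef-0∞ j)) (+-identityʳ _)))
            }
          ; inverse = (λ x → coefwise λ j → trans (coef-+∞ (-∞ x) x j) (trans (+-congʳ (coef-neg∞ x j)) (trans (-‿inverseˡ _) (sym (coef-0∞ j)))))
                    , (λ x → coefwise λ j → trans (coef-+∞ x (-∞ x) j) (trans (+-congˡ (coef-neg∞ x j)) (trans (-‿inverseʳ _) (sym (coef-0∞ j)))))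
          ; ⁻¹-cong = λ {x} {y} x≃y → coefwise λ j → trans (coef-neg∞ x j) (trans (-‿cong (coef-≈ x≃y j)) (sym (coef-neg∞ y j)))
          }
        ; comm = λ x y → coefwise λ j → trans (coef-+∞ x y j) (trans (+-comm _ _) (sym (coef-+∞ y x j)))
        }
      ; *-cong     = *∞-cong
      ; *-assoc    = *∞-assoc
      ; *-identity = *∞-identityˡ , (λ x → coefwise λ j → trans (coef-≈ (*∞-comm x 1∞) j) (coef-≈ (*∞-identityˡ x) j))
      ; distrib    = *∞-distribˡ
                   , (λ x y z → coefwise λ j → trans (coef-≈ (*∞-comm (y +∞ z) x) j) (trans (coef-≈ (*∞-distribˡ x y z) j)
                       (coef-≈ (+∞-cong (*∞-comm x y) (*∞-comm x z)) j)))
      }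
    ; *-comm = *∞-comm
    }

  K∞-ring : CommutativeRing c ℓ
  K∞-ring = record { isCommutativeRing = K∞-isCommutativeRing }

  module K∞Solver = IntegerCoefficientSolver K∞-ring

module LaurentDegrees {c ℓ : Level} (F : FiniteField c ℓ) where
  open FiniteField F hiding (zero)
  open Over F
  open FieldProperties F using (2#; inverse-nonzero)
  open PowerSeries F
  open LaurentSeries F
  open IntegerArithmetic
  open import Relation.Binary.Reasoning.Setoid setoid
  open import Algebra.Properties.Ring ring using (-0#≈0#)
  open ℤ-Solver using (solve-∀)
  private module K = CommutativeRing K∞-ring

  Deg≤ : K∞ → ℤ → Set ℓ
  Deg≤ x e = ∀ j → e ℤ.< j → coef∞ x j ≈ 0#

  Deg< : K∞ → ℤ → Set ℓ
  Deg< x e = ∀ j → e ℤ.≤ j → coef∞ x j ≈ 0#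

  Leading : K∞ → ℤ → Carrier → Set ℓ
  Leading x e a = Deg≤ x e × coef∞ x e ≈ a

  Deg≤-cong : ∀ {x y e} → x ≃ y → Deg≤ x e → Deg≤ y e
  Deg≤-cong x≃y x≤e j e<j = trans (sym (coef-≈ x≃y j)) (x≤e j e<j)

  Deg≤-mono : ∀ {x e e′} → e ℤ.≤ e′ → Deg≤ x e → Deg≤ x e′
  Deg≤-mono e≤e′ x≤e j e′<j = x≤e j (ℤP.≤-<-trans e≤e′ e′<j)

  Deg≤⇒Deg< : ∀ {x e e′} → Deg≤ x e → e ℤ.< e′ → Deg< x e′
  Deg≤⇒Deg< x≤e e<e′ j e′≤j = x≤e j (ℤP.<-≤-trans e<e′ e′≤j)

  Deg<⇒Deg≤ : ∀ {x e} → Deg< x e → Deg≤ x (e ℤ.- ℤ.1ℤ)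
  Deg<⇒Deg≤ {x} {e} x<e j e-1<j = x<e j (≡.subst (ℤ._≤ j) (1+[e-1]≡e e) (ℤP.i<j⇒suc[i]≤j e-1<j))
    where
    1+[e-1]≡e : ∀ e → ℤ.1ℤ ℤ.+ (e ℤ.- ℤ.1ℤ) ≡ e
    1+[e-1]≡e = solve-∀

  Deg<-cong : ∀ {x y e} → x ≃ y → Deg< x e → Deg< y e
  Deg<-cong x≃y x<e j e≤j = trans (sym (coef-≈ x≃y j)) (x<e j e≤j)

  Deg<-+ : ∀ {x y e} → Deg< x e → Deg< y e → Deg< (x +∞ y) e
  Deg<-+ {x} {y} x<e y<e j e≤j = trans (coef-+∞ x y j) (trans (+-cong (x<e j e≤j) (y<e j e≤j)) (+-identityˡ 0#))

  Deg<-zero : ∀ {x} e → x ≃ 0∞ → Deg< x e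
  Deg<-zero e x≃0 j _ = trans (coef-≈ x≃0 j) (coef-0∞ j)

  Leading-cong : ∀ {x y e a} → x ≃ y → Leading x e a → Leading y e a
  Leading-cong {e = e} x≃y (x≤e , xₑ≈a) = Deg≤-cong x≃y x≤e , trans (sym (coef-≈ x≃y e)) xₑ≈a

  Leading-≈ : ∀ {x e a b} → a ≈ b → Leading x e a → Leading x e b
  Leading-≈ a≈b (x≤e , xₑ≈a) = x≤e , trans xₑ≈a a≈b

  Leading-zero : ∀ {x} e → x ≃ 0∞ → Leading x e 0#
  Leading-zero e x≃0 = (λ j _ → trans (coef-≈ x≃0 j) (coef-0∞ j)) , trans (coef-≈ x≃0 e) (coef-0∞ e)

  Leading-low : ∀ {x e e′} → Deg≤ x e′ → e′ ℤ.< e → Leading x e 0#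
  Leading-low x≤e′ e′<e = Deg≤-mono (ℤP.<⇒≤ e′<e) x≤e′ , x≤e′ _ e′<e

  Leading-+ : ∀ {x y e a b} → Leading x e a → Leading y e b → Leading (x +∞ y) e (a + b)
  Leading-+ {x} {y} {e} (x≤e , xₑ≈a) (y≤e , yₑ≈b) =
    (λ j e<j → trans (coef-+∞ x y j) (trans (+-cong (x≤e j e<j) (y≤e j e<j)) (+-identityˡ 0#))) ,
    trans (coef-+∞ x y e) (+-cong xₑ≈a yₑ≈b)

  Leading-neg : ∀ {x e a} → Leading x e a → Leading (-∞ x) e (- a)
  Leading-neg {x} {e} (x≤e , xₑ≈a) =
    (λ j e<j → trans (coef-neg∞ x j) (trans (-‿cong (x≤e j e<j)) -0#≈0#)) , trans (coef-neg∞ x e) (-‿cong xₑ≈a)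

  laurent-u^-Deg≤ : ∀ M i h → Deg≤ (laurent M (u^ i ⋆ h)) (+ M ℤ.- + i)
  laurent-u^-Deg≤ M i h j M-i<j with exponent-split M j
  ... | inj₂ (m , ≡.refl , M<m) = coef-beyond M _ m M<m
  ... | inj₁ (k , ≡.refl)       = trans (coef-within M _ k) (u^⋆-low i h k (N-i<N-k⇒k<i M M-i<j))

  laurent-u^-coef : ∀ M i h → coef∞ (laurent M (u^ i ⋆ h)) (+ M ℤ.- + i) ≈ h 0
  laurent-u^-coef M i h = trans (coef-within M _ i) (trans (reflexive (≡.cong (u^ i ⋆ h) (≡.sym (ℕP.+-identityʳ i)))) (u^⋆-shift i h 0))

  -- x = t^e · h(1/t) with h a power series.
  record NormalForm (x : K∞) (e : ℤ) : Set (c ⊔ ℓ) where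
    field
      top gap  : ℕ
      series   : Series
      degree   : + top ℤ.- + gap ≡ e
      ≃-normal : x ≃ laurent top (u^ gap ⋆ series)

    leading : series 0 ≈ coef∞ x e
    leading = begin
      series 0                                          ≈⟨ laurent-u^-coef top gap series ⟨
      coef∞ (laurent top (u^ gap ⋆ series)) (+ top ℤ.- + gap) ≡⟨ ≡.cong (coef∞ (laurent top (u^ gap ⋆ series))) degree ⟩
      coef∞ (laurent top (u^ gap ⋆ series)) e           ≈⟨ coef-≈ ≃-normal e ⟨
      coef∞ x e                                         ∎

  -- Raise the top so that it lies above e, then factor out the vanishing
  -- coefficients between the top and e.
  Deg≤⇒NormalForm : ∀ x e → Deg≤ x e → NormalForm x e
  Deg≤⇒NormalForm (laurent N f) e x≤e = record
    { top = M ; gap = gap ; series = λ k → f′ (gap +ₙ k) ; degree = ≡.sym e≡M-gap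
    ; ≃-normal = coefwise λ j → trans (raised j) (laurent-cong ≡.refl (factor-u^ gap f′ f′-low) j) }
    where
    M = N +ₙ ℤ.∣ e ∣
    gap = ℤ.∣ + M ℤ.- e ∣
    e≤M : e ℤ.≤ + M
    e≤M = ℤP.≤-trans (i≤+∣i∣ e) (ℤ.+≤+ (ℕP.m≤n+m ℤ.∣ e ∣ N))
    e≡M-gap : e ≡ + M ℤ.- + gap
    e≡M-gap = ≡.trans (≡.sym (m-[m-n]≡n (+ M) e)) (≡.cong (λ i → + M ℤ.- i) (≡.sym (ℤP.0≤i⇒+∣i∣≡i (ℤP.i≤j⇒0≤j-i e≤M))))
    f′ = u^ ℤ.∣ e ∣ ⋆ f
    raised : laurent N f ≈∞ laurent M f′
    raised = laurent-shift N f ℤ.∣ e ∣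
    f′-low : ∀ k → k <ₙ gap → f′ k ≈ 0#
    f′-low k k<gap = trans (sym (coef-within M f′ k)) (trans (sym (raised (+ M ℤ.- + k)))
      (x≤e (+ M ℤ.- + k) (≡.subst (ℤ._< + M ℤ.- + k) (≡.sym e≡M-gap) (N-i<N-k M k<gap))))

  Leading-* : ∀ {x y e e′ a b} → Leading x e a → Leading y e′ b → Leading (x *∞ y) (e ℤ.+ e′) (a * b)
  Leading-* {x} {y} {e} {e′} {a} {b} (x≤e , xₑ≈a) (y≤e′ , yₑ′≈b) =
    Deg≤-cong (K.sym x*y≃) (≡.subst (Deg≤ product) degree (laurent-u^-Deg≤ (X.top +ₙ Y.top) (X.gap +ₙ Y.gap) (X.series ⋆ Y.series))) ,
    (begin
      coef∞ (x *∞ y) (e ℤ.+ e′)       ≈⟨ coef-≈ x*y≃ (e ℤ.+ e′) ⟩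
      coef∞ product (e ℤ.+ e′)        ≡⟨ ≡.cong (coef∞ product) degree ⟨
      coef∞ product (+ (X.top +ₙ Y.top) ℤ.- + (X.gap +ₙ Y.gap)) ≈⟨ laurent-u^-coef (X.top +ₙ Y.top) (X.gap +ₙ Y.gap) (X.series ⋆ Y.series) ⟩
      X.series 0 * Y.series 0         ≈⟨ *-cong (trans X.leading xₑ≈a) (trans Y.leading yₑ′≈b) ⟩
      a * b                           ∎)
    where
    module X = NormalForm (Deg≤⇒NormalForm x e x≤e)
    module Y = NormalForm (Deg≤⇒NormalForm y e′ y≤e′)
    product = laurent (X.top +ₙ Y.top) (u^ (X.gap +ₙ Y.gap) ⋆ (X.series ⋆ Y.series))
    x*y≃ : x *∞ y ≃ product
    x*y≃ = K.trans (K.*-cong X.≃-normal Y.≃-normal) (coefwise (laurent-cong ≡.refl λ k → trans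
      (⋆-interchange (u^ X.gap) X.series (u^ Y.gap) Y.series k)
      (⋆-congʳ {g = X.series ⋆ Y.series} (λ k → sym (u^-+ X.gap Y.gap k)) k)))
    degree : + (X.top +ₙ Y.top) ℤ.- + (X.gap +ₙ Y.gap) ≡ e ℤ.+ e′
    degree = ≡.trans (≡.cong₂ ℤ._-_ (ℤP.pos-+ X.top Y.top) (ℤP.pos-+ X.gap Y.gap))
      (≡.trans (interchange (+ X.top) (+ Y.top) (+ X.gap) (+ Y.gap)) (≡.cong₂ ℤ._+_ X.degree Y.degree))
      where
      interchange : ∀ a b c d → (a ℤ.+ b) ℤ.- (c ℤ.+ d) ≡ (a ℤ.- c) ℤ.+ (b ℤ.- d)
      interchange = solve-∀

  inverse∞ : ∀ z e → Deg≤ z e → ¬ (coef∞ z e ≈ 0#) →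
             Σ K∞ λ w → w *∞ z ≃ 1∞ × Deg≤ w (ℤ.- e) × ¬ (coef∞ w (ℤ.- e) ≈ 0#)
  inverse∞ z e z≤e zₑ≉0 = w , w*z≃1 , ≡.subst (Deg≤ w) degree (laurent-u^-Deg≤ Z.gap Z.top h⁻¹) , w₋ₑ≉0
    where
    module Z = NormalForm (Deg≤⇒NormalForm z e z≤e)
    h₀≉0 : ¬ (Z.series 0 ≈ 0#)
    h₀≉0 h₀≈0 = zₑ≉0 (trans (sym Z.leading) h₀≈0)
    h⁻¹ = proj₁ (⋆-inverse Z.series h₀≉0)
    h⁻¹⋆h≋𝟙 = proj₂ (⋆-inverse Z.series h₀≉0)
    w = laurent Z.gap (u^ Z.top ⋆ h⁻¹)
    degree : + Z.gap ℤ.- + Z.top ≡ ℤ.- e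
    degree = ≡.trans (swap (+ Z.top) (+ Z.gap)) (≡.cong ℤ.-_ Z.degree)
      where
      swap : ∀ a b → b ℤ.- a ≡ ℤ.- (a ℤ.- b)
      swap = solve-∀
    w*z≃1 : w *∞ z ≃ 1∞
    w*z≃1 = K.trans (K.*-cong K.refl Z.≃-normal) (coefwise λ j → begin
      coef∞ (laurent (Z.gap +ₙ Z.top) ((u^ Z.top ⋆ h⁻¹) ⋆ (u^ Z.gap ⋆ Z.series))) j ≈⟨ laurent-cong ≡.refl collect j ⟩
      coef∞ (laurent (Z.gap +ₙ Z.top) (u^ (Z.top +ₙ Z.gap) ⋆ 𝟙)) j                   ≈⟨ laurent-u^-reindex (Z.gap +ₙ Z.top) (Z.top +ₙ Z.gap) 0 0 𝟙 degree-0 j ⟩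
      coef∞ (laurent 0 (𝟙 ⋆ 𝟙)) j                                                  ≈⟨ laurent-cong ≡.refl (⋆-identityˡ 𝟙) j ⟩
      coef∞ 1∞ j                                                                   ∎)
      where
      collect : (u^ Z.top ⋆ h⁻¹) ⋆ (u^ Z.gap ⋆ Z.series) ≋ u^ (Z.top +ₙ Z.gap) ⋆ 𝟙
      collect k = trans (⋆-interchange (u^ Z.top) h⁻¹ (u^ Z.gap) Z.series k)
        (⋆-cong (λ k → sym (u^-+ Z.top Z.gap k)) h⁻¹⋆h≋𝟙 k)
      degree-0 : + (Z.gap +ₙ Z.top) ℤ.- + (Z.top +ₙ Z.gap) ≡ + 0 ℤ.- + 0
      degree-0 = ≡.trans (≡.cong (λ n → + (Z.gap +ₙ Z.top) ℤ.- + n) (ℕP.+-comm Z.top Z.gap)) (ℤP.+-inverseʳ (+ (Z.gap +ₙ Z.top)))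
    w₋ₑ≉0 : ¬ (coef∞ w (ℤ.- e) ≈ 0#)
    w₋ₑ≉0 w₋ₑ≈0 = inverse-nonzero (h⁻¹⋆h≋𝟙 0) (begin
      h⁻¹ 0                                                   ≈⟨ laurent-u^-coef Z.gap Z.top h⁻¹ ⟨
      coef∞ w (+ Z.gap ℤ.- + Z.top)                           ≡⟨ ≡.cong (coef∞ w) degree ⟩
      coef∞ w (ℤ.- e)                                         ≈⟨ w₋ₑ≈0 ⟩
      0#                                                      ∎)

  sqrt∞ : ∀ z e r → Leading z (e ℤ.+ e) (r * r) → ¬ (r ≈ 0#) → ¬ (2# ≈ 0#) → Σ K∞ λ s → s *∞ s ≃ z
  sqrt∞ z e r (z≤2e , z₂ₑ≈r²) r≉0 2≉0 = s , coefwise λ j → begin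
    coef∞ (s *∞ s) j                                        ≈⟨ laurent-cong ≡.refl square j ⟩
    coef∞ (laurent (τ +ₙ τ) (u^ (ν +ₙ ν) ⋆ Z.series)) j     ≈⟨ laurent-u^-reindex (τ +ₙ τ) (ν +ₙ ν) Z.top Z.gap Z.series degree j ⟩
    coef∞ (laurent Z.top (u^ Z.gap ⋆ Z.series)) j           ≈⟨ coef-≈ Z.≃-normal j ⟨
    coef∞ z j                                               ∎
    where
    module Z = NormalForm (Deg≤⇒NormalForm z (e ℤ.+ e) z≤2e)
    √h = proj₁ (⋆-sqrt Z.series r (trans Z.leading z₂ₑ≈r²) r≉0 2≉0)
    √h⋆√h≋h = proj₂ (⋆-sqrt Z.series r (trans Z.leading z₂ₑ≈r²) r≉0 2≉0)
    τ = ℤ.∣ e ∣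
    ν = ℤ.∣ + τ ℤ.- e ∣
    +ν≡τ-e : + ν ≡ + τ ℤ.- e
    +ν≡τ-e = ℤP.0≤i⇒+∣i∣≡i (ℤP.i≤j⇒0≤j-i (i≤+∣i∣ e))
    s = laurent τ (u^ ν ⋆ √h)
    square : (u^ ν ⋆ √h) ⋆ (u^ ν ⋆ √h) ≋ u^ (ν +ₙ ν) ⋆ Z.series
    square k = trans (⋆-interchange (u^ ν) √h (u^ ν) √h k)
      (⋆-cong (λ k → sym (u^-+ ν ν k)) √h⋆√h≋h k)
    degree : + (τ +ₙ τ) ℤ.- + (ν +ₙ ν) ≡ + Z.top ℤ.- + Z.gap
    degree = ≡.trans (≡.cong₂ ℤ._-_ (ℤP.pos-+ τ τ) (≡.trans (ℤP.pos-+ ν ν) (≡.cong₂ ℤ._+_ +ν≡τ-e +ν≡τ-e)))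
      (≡.trans (halve (+ τ) e) (≡.sym Z.degree))
      where
      halve : ∀ t e → (t ℤ.+ t) ℤ.- ((t ℤ.- e) ℤ.+ (t ℤ.- e)) ≡ e ℤ.+ e
      halve = solve-∀

module Embedding {c ℓ : Level} (F : FiniteField c ℓ) where
  open FiniteField F hiding (zero)
  open Over F
  open FiniteSums F using (sumTo-cong; sumTo-*ˡ)
  open PowerSeries F
  open LaurentSeries F
  open LaurentDegrees F
  open IntegerArithmetic
  open import Algebra.Properties.Ring ring using (-0#≈0#)
  open ℤ-Solver using (solve-∀)
  private module K = CommutativeRing K∞-ring

  coeff-beyond-length : ∀ p n → length p ≤ₙ n → coeff p n ≡ 0#
  coeff-beyond-length []      n       _         = ≡.refl
  coeff-beyond-length (a ∷ p) (suc n) (s≤s len≤n) = coeff-beyond-length p n len≤n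

  coeff-+ₚ : ∀ p q n → coeff (p +ₚ q) n ≈ coeff p n + coeff q n
  coeff-+ₚ []      q       n       = sym (+-identityˡ _)
  coeff-+ₚ (a ∷ p) []      n       = sym (+-identityʳ _)
  coeff-+ₚ (a ∷ p) (b ∷ q) zero    = refl
  coeff-+ₚ (a ∷ p) (b ∷ q) (suc n) = coeff-+ₚ p q n

  coeff-scale : ∀ a q n → coeff (map (a *_) q) n ≈ a * coeff q n
  coeff-scale a []      n       = sym (zeroʳ a)
  coeff-scale a (b ∷ q) zero    = refl
  coeff-scale a (b ∷ q) (suc n) = coeff-scale a q n

  coeff-negₚ : ∀ p n → coeff (-ₚ p) n ≈ - coeff p n
  coeff-negₚ []      n       = sym -0#≈0#
  coeff-negₚ (a ∷ p) zero    = refl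
  coeff-negₚ (a ∷ p) (suc n) = coeff-negₚ p n

  degₚ-just : ∀ p d → degₚ p ≡ just d → ¬ (coeff p d ≈ 0#) × (∀ n → d <ₙ n → coeff p n ≈ 0#)
  degₚ-nothing : ∀ p → degₚ p ≡ nothing → IsZeroₚ p
  degₚ-just [] d ()
  degₚ-just (a ∷ p) d e with degₚ p in deg-p
  degₚ-just (a ∷ p) .(suc d′) ≡.refl | just d′ =
    proj₁ (degₚ-just p d′ deg-p) , λ { (suc n) (s≤s d′<n) → proj₂ (degₚ-just p d′ deg-p) n d′<n }
  degₚ-just (a ∷ p) d e | nothing with a ≟ 0#
  degₚ-just (a ∷ p) d () | nothing | yes _
  degₚ-just (a ∷ p) .0 ≡.refl | nothing | no a≉0 = a≉0 , λ { (suc n) _ → degₚ-nothing p deg-p n }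
  degₚ-nothing [] e n = refl
  degₚ-nothing (a ∷ p) e n with degₚ p in deg-p
  degₚ-nothing (a ∷ p) () n | just d′
  degₚ-nothing (a ∷ p) e n | nothing with a ≟ 0#
  degₚ-nothing (a ∷ p) e zero    | nothing | yes a≈0 = a≈0
  degₚ-nothing (a ∷ p) e (suc n) | nothing | yes a≈0 = degₚ-nothing p deg-p n
  degₚ-nothing (a ∷ p) () n | nothing | no _

  nonzero⇒degₚ-just : ∀ p → ¬ IsZeroₚ p → Σ ℕ λ d → degₚ p ≡ just d
  nonzero⇒degₚ-just p p≉0 with degₚ p in deg-p
  ... | just d  = d , ≡.refl
  ... | nothing = ⊥-elim (p≉0 (degₚ-nothing p deg-p))

  coef-emb : ∀ p j → coef∞ (emb p) j ≈ coeffℤ p j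
  coef-emb p j with exponent-split (length p) j
  ... | inj₁ (k , ≡.refl)          = coef-within (length p) _ k
  ... | inj₂ (m , ≡.refl , len<m) = trans (coef-beyond (length p) _ m len<m) (reflexive (≡.sym (coeff-beyond-length p m (ℕP.<⇒≤ len<m))))

  emb-cong : ∀ {p q} → p ≈ₚ q → emb p ≃ emb q
  emb-cong {p} {q} p≈q = coefwise λ j → trans (coef-emb p j) (trans (coeffℤ-cong j) (sym (coef-emb q j)))
    where
    coeffℤ-cong : ∀ j → coeffℤ p j ≈ coeffℤ q j
    coeffℤ-cong (+ n)    = p≈q n
    coeffℤ-cong -[1+ n ] = refl

  emb-zero : ∀ p → IsZeroₚ p → emb p ≃ 0∞
  emb-zero p p≈0 = coefwise λ j → trans (coef-emb p j) (trans (coeffℤ-zero j) (sym (coef-0∞ j)))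
    where
    coeffℤ-zero : ∀ j → coeffℤ p j ≈ 0#
    coeffℤ-zero (+ n)    = p≈0 n
    coeffℤ-zero -[1+ n ] = refl

  emb-0ₚ : emb 0ₚ ≃ 0∞
  emb-0ₚ = emb-zero 0ₚ (λ _ → refl)

  emb-+ₚ : ∀ p q → emb (p +ₚ q) ≃ emb p +∞ emb q
  emb-+ₚ p q = coefwise λ j → trans (coef-emb (p +ₚ q) j) (trans (coeffℤ-+ j)
    (sym (trans (coef-+∞ (emb p) (emb q) j) (+-cong (coef-emb p j) (coef-emb q j)))))
    where
    coeffℤ-+ : ∀ j → coeffℤ (p +ₚ q) j ≈ coeffℤ p j + coeffℤ q j
    coeffℤ-+ (+ n)    = coeff-+ₚ p q n
    coeffℤ-+ -[1+ n ] = sym (+-identityˡ 0#)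

  emb-negₚ : ∀ p → emb (-ₚ p) ≃ -∞ emb p
  emb-negₚ p = coefwise λ j → trans (coef-emb (-ₚ p) j) (trans (coeffℤ-neg j)
    (sym (trans (coef-neg∞ (emb p) j) (-‿cong (coef-emb p j)))))
    where
    coeffℤ-neg : ∀ j → coeffℤ (-ₚ p) j ≈ - coeffℤ p j
    coeffℤ-neg (+ n)    = coeff-negₚ p n
    coeffℤ-neg -[1+ n ] = sym -0#≈0#

  emb-degree : ∀ p d → degₚ p ≡ just d → Deg≤ (emb p) (+ d) × ¬ (coef∞ (emb p) (+ d) ≈ 0#)
  emb-degree p d deg-p =
    (λ { (+ n) (ℤ.+<+ d<n) → trans (coef-emb p (+ n)) (proj₂ (degₚ-just p d deg-p) n d<n) }) ,
    (λ pᵈ≈0 → proj₁ (degₚ-just p d deg-p) (trans (sym (coef-emb p (+ d))) pᵈ≈0))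

  const∞ : Carrier → K∞
  const∞ a = laurent 0 (λ k → a * 𝟙 k)

  t∞ : K∞
  t∞ = emb (0# ∷ 1# ∷ [])

  coef-const∞ : ∀ a j → coef∞ (const∞ a) j ≈ coeffℤ (a ∷ []) j
  coef-const∞ a j with exponent-split 0 j
  ... | inj₁ (zero , ≡.refl)         = trans (coef-within 0 (λ k → a * 𝟙 k) 0) (*-identityʳ a)
  ... | inj₁ (suc k , ≡.refl)        = trans (coef-within 0 (λ k → a * 𝟙 k) (suc k)) (zeroʳ a)
  ... | inj₂ (suc m , ≡.refl , 0<m) = coef-beyond 0 (λ k → a * 𝟙 k) (suc m) 0<m

  coef-const∞-* : ∀ a y j → coef∞ (const∞ a *∞ y) j ≈ a * coef∞ y j
  coef-const∞-* a (laurent N f) j = trans (laurent-cong ≡.refl scaled j) (coef-scaled j)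
    where
    scaled : (λ k → a * 𝟙 k) ⋆ f ≋ (λ k → a * f k)
    scaled k = trans (sumTo-cong k (λ i _ → *-assoc _ _ _)) (trans (sym (sumTo-*ˡ k a _)) (*-congˡ (⋆-identityˡ f k)))
    coef-scaled : ∀ j → coef∞ (laurent N (λ k → a * f k)) j ≈ a * coef∞ (laurent N f) j
    coef-scaled j with + N ℤ.- j
    ... | + n      = refl
    ... | -[1+ n ] = sym (zeroʳ a)

  coef-t∞-* : ∀ y j → coef∞ (t∞ *∞ y) j ≈ coef∞ y (j ℤ.- ℤ.1ℤ)
  coef-t∞-* (laurent N f) j = begin
    coef∞ (laurent (2 +ₙ N) (t-series ⋆ f)) j           ≈⟨ laurent-cong ≡.refl (⋆-congʳ {g = f} t-series≋u) j ⟩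
    coef∞ (laurent (2 +ₙ N) (u^ 1 ⋆ f)) j               ≈⟨ laurent-cong (ℕP.+-comm 1 (suc N)) (λ _ → refl) j ⟩
    coef∞ (laurent (suc N +ₙ 1) (u^ 1 ⋆ f)) j           ≈⟨ laurent-shift (suc N) f 1 j ⟨
    coef∞ (laurent (suc N) f) j                         ≈⟨ lower j ⟩
    coef∞ (laurent N f) (j ℤ.- ℤ.1ℤ)                    ∎
    where
    open import Relation.Binary.Reasoning.Setoid setoid
    t-series : Series
    t-series k = coeffℤ (0# ∷ 1# ∷ []) (+ 2 ℤ.- + k)
    t-series≋u : t-series ≋ u^ 1
    t-series≋u k = sym (trans (⋆-comm u 𝟙 k) (trans (⋆-identityˡ u k) (u≋t-series k)))
      where
      u≋t-series : ∀ k → u k ≈ t-series k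
      u≋t-series zero                = refl
      u≋t-series (suc zero)          = refl
      u≋t-series (suc (suc zero))    = refl
      u≋t-series (suc (suc (suc k))) = refl
    lower : ∀ j → coef∞ (laurent (suc N) f) j ≈ coef∞ (laurent N f) (j ℤ.- ℤ.1ℤ)
    lower j with exponent-split (suc N) j
    ... | inj₁ (k , ≡.refl) = trans (coef-within (suc N) f k) (sym (coef-within′ N f k (reindex (+ N) (+ k))))
      where
      reindex : ∀ a b → ((ℤ.1ℤ ℤ.+ a) ℤ.- b) ℤ.- ℤ.1ℤ ≡ a ℤ.- b
      reindex = solve-∀
    ... | inj₂ (suc m , ≡.refl , s≤s N<m) = trans (coef-beyond (suc N) f (suc m) (s≤s N<m)) (sym (coef-beyond′ N f m (reindex (+ m)) N<m))
      where
      reindex : ∀ a → (ℤ.1ℤ ℤ.+ a) ℤ.- ℤ.1ℤ ≡ a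
      reindex = solve-∀

  emb-∷ : ∀ a p → emb (a ∷ p) ≃ const∞ a +∞ (t∞ *∞ emb p)
  emb-∷ a p = coefwise λ j → trans (coef-emb (a ∷ p) j) (trans (split j) (sym (trans (coef-+∞ (const∞ a) (t∞ *∞ emb p) j)
    (+-cong (coef-const∞ a j) (trans (coef-t∞-* (emb p) j) (coef-emb p (j ℤ.- ℤ.1ℤ)))))))
    where
    split : ∀ j → coeffℤ (a ∷ p) j ≈ coeffℤ (a ∷ []) j + coeffℤ p (j ℤ.- ℤ.1ℤ)
    split (+ zero)  = sym (+-identityʳ a)
    split (+ suc m) = sym (+-identityˡ _)
    split -[1+ m ]  = sym (+-identityˡ 0#)

  emb-scale : ∀ a q → emb (map (a *_) q) ≃ const∞ a *∞ emb q
  emb-scale a q = coefwise λ j → trans (coef-emb _ j) (trans (coeffℤ-scale j) (sym (trans (coef-const∞-* a (emb q) j) (*-congˡ (coef-emb q j)))))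
    where
    coeffℤ-scale : ∀ j → coeffℤ (map (a *_) q) j ≈ a * coeffℤ q j
    coeffℤ-scale (+ n)    = coeff-scale a q n
    coeffℤ-scale -[1+ n ] = sym (zeroʳ a)

  const∞-0# : const∞ 0# ≃ 0∞
  const∞-0# = coefwise λ j → trans (coef-const∞ 0# j) (trans (zero-poly j) (sym (coef-0∞ j)))
    where
    zero-poly : ∀ j → coeffℤ (0# ∷ []) j ≈ 0#
    zero-poly (+ zero)  = refl
    zero-poly (+ suc n) = refl
    zero-poly -[1+ n ]  = refl

  emb-*ₚ : ∀ p q → emb (p *ₚ q) ≃ emb p *∞ emb q
  emb-*ₚ []      q = K.trans emb-0ₚ (K.sym (K.trans (K.*-congʳ {emb q} emb-0ₚ) (K.zeroˡ (emb q))))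
  emb-*ₚ (a ∷ p) q = begin
    emb (map (a *_) q +ₚ (0# ∷ (p *ₚ q)))                      ≈⟨ emb-+ₚ _ _ ⟩
    emb (map (a *_) q) +∞ emb (0# ∷ (p *ₚ q))                  ≈⟨ K.+-cong (emb-scale a q) (emb-∷ 0# (p *ₚ q)) ⟩
    (const∞ a *∞ emb q) +∞ (const∞ 0# +∞ (t∞ *∞ emb (p *ₚ q)))  ≈⟨ K.+-congˡ (K.+-cong const∞-0# (K.*-congˡ {t∞} (emb-*ₚ p q))) ⟩
    (const∞ a *∞ emb q) +∞ (0∞ +∞ (t∞ *∞ (emb p *∞ emb q)))     ≈⟨ solve 4 (λ C Q T P → C :* Q :+ (con (+ 0) :+ T :* (P :* Q)) := (C :+ T :* P) :* Q) K.refl (const∞ a) (emb q) t∞ (emb p) ⟩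
    (const∞ a +∞ (t∞ *∞ emb p)) *∞ emb q                       ≈⟨ K.*-congʳ {emb q} (emb-∷ a p) ⟨
    emb (a ∷ p) *∞ emb q                                       ∎
    where
    open import Relation.Binary.Reasoning.Setoid K.setoid
    open K∞Solver

  emb-1ₚ : emb 1ₚ ≃ 1∞
  emb-1ₚ = coefwise λ j → trans (coef-emb 1ₚ j) (trans (sym (coef-const∞ 1# j)) (laurent-cong ≡.refl (λ k → *-identityˡ _) j))

module Representatives {c ℓ : Level} (F : FiniteField c ℓ) where
  open FiniteField F hiding (zero)
  open Over F
  open FieldProperties F using (*-nonzero)
  open LaurentSeries F
  open LaurentDegrees F
  open Embedding F
  private module K = CommutativeRing K∞-ring
  open import Relation.Binary.Reasoning.Setoid K.setoid
  open K∞Solver using (solve; _:+_; _:*_; _:=_; :-_)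

  represents-cong : ∀ {y y′ x} → y ≃ y′ → y represents x → y′ represents x
  represents-cong {x = x} y≃y′ y-rep = coef-≈ (K.trans (K.*-congʳ {emb (den x)} (K.sym y≃y′)) (coefwise y-rep))

  represents-ι : ∀ p → emb p represents ι p
  represents-ι p = coef-≈ (K.trans (K.*-congˡ {emb p} emb-1ₚ) (K.*-identityʳ (emb p)))

  represents-*K : ∀ {y₁ y₂} x₁ x₂ → y₁ represents x₁ → y₂ represents x₂ → (y₁ *∞ y₂) represents (x₁ *K x₂)
  represents-*K {y₁} {y₂} (a / b) (a′ / b′) y₁-rep y₂-rep = coef-≈ (begin
    (y₁ *∞ y₂) *∞ emb (b *ₚ b′)          ≈⟨ K.*-congˡ {y₁ *∞ y₂} (emb-*ₚ b b′) ⟩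
    (y₁ *∞ y₂) *∞ (emb b *∞ emb b′)      ≈⟨ solve 4 (λ y₁ y₂ B B′ → (y₁ :* y₂) :* (B :* B′) := (y₁ :* B) :* (y₂ :* B′)) K.refl y₁ y₂ (emb b) (emb b′) ⟩
    (y₁ *∞ emb b) *∞ (y₂ *∞ emb b′)      ≈⟨ K.*-cong (coefwise y₁-rep) (coefwise y₂-rep) ⟩
    emb a *∞ emb a′                      ≈⟨ emb-*ₚ a a′ ⟨
    emb (a *ₚ a′)                        ∎)

  represents-+K : ∀ {y₁ y₂} x₁ x₂ → y₁ represents x₁ → y₂ represents x₂ → (y₁ +∞ y₂) represents (x₁ +K x₂)
  represents-+K {y₁} {y₂} (a / b) (a′ / b′) y₁-rep y₂-rep = coef-≈ (begin
    (y₁ +∞ y₂) *∞ emb (b *ₚ b′)                              ≈⟨ K.*-congˡ {y₁ +∞ y₂} (emb-*ₚ b b′) ⟩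
    (y₁ +∞ y₂) *∞ (emb b *∞ emb b′)                          ≈⟨ solve 4 (λ y₁ y₂ B B′ → (y₁ :+ y₂) :* (B :* B′) := ((y₁ :* B) :* B′) :+ ((y₂ :* B′) :* B)) K.refl y₁ y₂ (emb b) (emb b′) ⟩
    ((y₁ *∞ emb b) *∞ emb b′) +∞ ((y₂ *∞ emb b′) *∞ emb b)   ≈⟨ K.+-cong (K.*-congʳ {emb b′} (coefwise y₁-rep)) (K.*-congʳ {emb b} (coefwise y₂-rep)) ⟩
    (emb a *∞ emb b′) +∞ (emb a′ *∞ emb b)                   ≈⟨ K.+-cong (emb-*ₚ a b′) (emb-*ₚ a′ b) ⟨
    emb (a *ₚ b′) +∞ emb (a′ *ₚ b)                           ≈⟨ emb-+ₚ (a *ₚ b′) (a′ *ₚ b) ⟨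
    emb ((a *ₚ b′) +ₚ (a′ *ₚ b))                             ∎)

  represents-negK : ∀ {y} x → y represents x → (-∞ y) represents (-K x)
  represents-negK {y} (a / b) y-rep = coef-≈ (begin
    (-∞ y) *∞ emb b     ≈⟨ solve 2 (λ y B → (:- y) :* B := :- (y :* B)) K.refl y (emb b) ⟩
    -∞ (y *∞ emb b)     ≈⟨ K.-‿cong (coefwise y-rep) ⟩
    -∞ emb a            ≈⟨ emb-negₚ a ⟨
    emb (-ₚ a)          ∎)

  *ₚ-nonzero : ∀ p q → ¬ IsZeroₚ p → ¬ IsZeroₚ q → ¬ IsZeroₚ (p *ₚ q)
  *ₚ-nonzero p q p≉0 q≉0 pq≈0 with nonzero⇒degₚ-just p p≉0 | nonzero⇒degₚ-just q q≉0
  ... | dp , deg-p | dq , deg-q =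
    *-nonzero (proj₂ (emb-degree p dp deg-p)) (proj₂ (emb-degree q dq deg-q))
      (trans (sym (proj₂ leading)) (trans (sym (coef-≈ (emb-*ₚ p q) e)) (trans (coef-≈ (emb-zero (p *ₚ q) pq≈0) e) (coef-0∞ e))))
    where
    e = + dp ℤ.+ + dq
    leading = Leading-* (proj₁ (emb-degree p dp deg-p) , refl) (proj₁ (emb-degree q dq deg-q) , refl)

  ι-IsK : ∀ p → IsK (ι p)
  ι-IsK p 1ₚ≈0 = 1≉0 (1ₚ≈0 0)

  *K-IsK : ∀ x z → IsK x → IsK z → IsK (x *K z)
  *K-IsK (a / b) (a′ / b′) = *ₚ-nonzero b b′

  +K-IsK : ∀ x z → IsK x → IsK z → IsK (x +K z)
  +K-IsK (a / b) (a′ / b′) = *ₚ-nonzero b b′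

  -K-IsK : ∀ x → IsK x → IsK (-K x)
  -K-IsK (a / b) b≉0 = b≉0


  record DenominatorInverse (x : Frac) : Set (c ⊔ ℓ) where
    field
      deg-den : ℕ
      degₚ-den : degₚ (den x) ≡ just deg-den
      den⁻¹ : K∞
      den⁻¹-inverse : den⁻¹ *∞ emb (den x) ≃ 1∞
      den⁻¹-Deg≤ : Deg≤ den⁻¹ (ℤ.- + deg-den)
      den⁻¹-leading≉0 : ¬ (coef∞ den⁻¹ (ℤ.- + deg-den) ≈ 0#)

    represents⇒≃ : ∀ {y} → y represents x → y ≃ emb (num x) *∞ den⁻¹
    represents⇒≃ {y} y-rep = begin
      y                                   ≈⟨ K.*-identityʳ y ⟨
      y *∞ 1∞                             ≈⟨ K.*-congˡ {y} den⁻¹-inverse ⟨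
      y *∞ (den⁻¹ *∞ emb (den x))         ≈⟨ solve 3 (λ y w D → y :* (w :* D) := (y :* D) :* w) K.refl y den⁻¹ (emb (den x)) ⟩
      (y *∞ emb (den x)) *∞ den⁻¹         ≈⟨ K.*-congʳ {den⁻¹} (coefwise y-rep) ⟩
      emb (num x) *∞ den⁻¹                ∎

    representative : (emb (num x) *∞ den⁻¹) represents x
    representative = coef-≈ (begin
      (emb (num x) *∞ den⁻¹) *∞ emb (den x)   ≈⟨ K.*-assoc (emb (num x)) den⁻¹ (emb (den x)) ⟩
      emb (num x) *∞ (den⁻¹ *∞ emb (den x))   ≈⟨ K.*-congˡ {emb (num x)} den⁻¹-inverse ⟩
      emb (num x) *∞ 1∞                       ≈⟨ K.*-identityʳ (emb (num x)) ⟩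
      emb (num x)                             ∎)

  denominatorInverse : ∀ x → IsK x → DenominatorInverse x
  denominatorInverse x x∈K = record
    { deg-den = d ; degₚ-den = deg-d ; den⁻¹ = proj₁ W ; den⁻¹-inverse = proj₁ (proj₂ W)
    ; den⁻¹-Deg≤ = proj₁ (proj₂ (proj₂ W)) ; den⁻¹-leading≉0 = proj₂ (proj₂ (proj₂ W)) }
    where
    d = proj₁ (nonzero⇒degₚ-just (den x) x∈K)
    deg-d = proj₂ (nonzero⇒degₚ-just (den x) x∈K)
    W = inverse∞ (emb (den x)) (+ d) (proj₁ (emb-degree _ d deg-d)) (proj₂ (emb-degree _ d deg-d))

  represented : ∀ x → IsK x → Σ K∞ (_represents x)
  represented x x∈K = _ , DenominatorInverse.representative (denominatorInverse x x∈K)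

  represents-unique : ∀ {x x′ y y′} → IsK x → IsK x′ → x ≈K x′ → y represents x → y′ represents x′ → y ≃ y′
  represents-unique {x} {x′} {y} {y′} x∈K x′∈K x≈x′ y-rep y′-rep = begin
    y                             ≈⟨ X.represents⇒≃ y-rep ⟩
    A *∞ w                        ≈⟨ K.*-identityʳ _ ⟨
    (A *∞ w) *∞ 1∞                ≈⟨ K.*-congˡ {A *∞ w} X′.den⁻¹-inverse ⟨
    (A *∞ w) *∞ (w′ *∞ B′)        ≈⟨ solve 4 (λ A w w′ B′ → (A :* w) :* (w′ :* B′) := (A :* B′) :* (w :* w′)) K.refl A w w′ B′ ⟩
    (A *∞ B′) *∞ (w *∞ w′)        ≈⟨ K.*-congʳ {w *∞ w′} cross ⟩
    (A′ *∞ B) *∞ (w *∞ w′)        ≈⟨ solve 4 (λ A′ B w w′ → (A′ :* B) :* (w :* w′) := (A′ :* w′) :* (w :* B)) K.refl A′ B w w′ ⟩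
    (A′ *∞ w′) *∞ (w *∞ B)        ≈⟨ K.*-congˡ {A′ *∞ w′} X.den⁻¹-inverse ⟩
    (A′ *∞ w′) *∞ 1∞              ≈⟨ K.*-identityʳ _ ⟩
    A′ *∞ w′                      ≈⟨ X′.represents⇒≃ y′-rep ⟨
    y′                            ∎
    where
    module X  = DenominatorInverse (denominatorInverse x x∈K)
    module X′ = DenominatorInverse (denominatorInverse x′ x′∈K)
    A = emb (num x)
    B = emb (den x)
    A′ = emb (num x′)
    B′ = emb (den x′)
    w = X.den⁻¹
    w′ = X′.den⁻¹
    cross : A *∞ B′ ≃ A′ *∞ B
    cross = K.trans (K.sym (emb-*ₚ (num x) (den x′))) (K.trans (emb-cong x≈x′) (emb-*ₚ (num x′) (den x)))

  HasDegree : K∞ → Deg → Set ℓ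
  HasDegree y nothing  = y ≃ 0∞
  HasDegree y (just e) = Deg≤ y e × ¬ (coef∞ y e ≈ 0#)

  private
    degK′ : Maybe ℕ → Maybe ℕ → Deg
    degK′ nothing  _        = nothing
    degK′ (just m) (just n) = just (+ m ℤ.- + n)
    degK′ (just m) nothing  = nothing

    degK-unfold : ∀ n d → degK (n / d) ≡ degK′ (degₚ n) (degₚ d)
    degK-unfold n d with degₚ n | degₚ d
    ... | nothing | _       = ≡.refl
    ... | just m  | just k  = ≡.refl
    ... | just m  | nothing = ≡.refl

  represents⇒HasDegree : ∀ {x y} → IsK x → y represents x → HasDegree y (degK x)
  represents⇒HasDegree {n / d} {y} x∈K y-rep
    rewrite degK-unfold n d | DenominatorInverse.degₚ-den (denominatorInverse (n / d) x∈K) with degₚ n in deg-n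
  ... | nothing = K.trans (X.represents⇒≃ y-rep) (K.trans (K.*-congʳ {X.den⁻¹} (emb-zero n (degₚ-nothing n deg-n))) (K.zeroˡ X.den⁻¹))
    where module X = DenominatorInverse (denominatorInverse (n / d) x∈K)
  ... | just m  = Deg≤-cong (K.sym y≃) (proj₁ leading) ,
                  λ yₑ≈0 → *-nonzero (proj₂ (emb-degree n m deg-n)) X.den⁻¹-leading≉0
                             (trans (sym (proj₂ leading)) (trans (sym (coef-≈ y≃ (+ m ℤ.- + X.deg-den))) yₑ≈0))
    where
    module X = DenominatorInverse (denominatorInverse (n / d) x∈K)
    y≃ = X.represents⇒≃ y-rep
    leading = Leading-* (proj₁ (emb-degree n m deg-n) , refl) (X.den⁻¹-Deg≤ , refl)

  HasDegree-<ᵈ : ∀ {y D e} → HasDegree y D → D <ᵈ just e → Deg< y e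
  HasDegree-<ᵈ {D = nothing} y≃0 -∞<           = Deg<-zero _ y≃0
  HasDegree-<ᵈ {D = just d} (y≤d , _) (fin< d<e) = Deg≤⇒Deg< y≤d d<e

  HasDegree-Deg< : ∀ {y D e} → HasDegree y D → Deg< y e → D <ᵈ just e
  HasDegree-Deg< {D = nothing} _ _ = -∞<
  HasDegree-Deg< {D = just d} {e} (_ , yd≉0) y<e with ℤP.<-cmp d e
  ... | tri< d<e _ _ = fin< d<e
  ... | tri≈ _ d≡e _ = ⊥-elim (yd≉0 (y<e d (ℤP.≤-reflexive (≡.sym d≡e))))
  ... | tri> _ _ e<d = ⊥-elim (yd≉0 (y<e d (ℤP.<⇒≤ e<d)))

  HasDegree-unique : ∀ {y D e} → HasDegree y D → Deg≤ y e → ¬ (coef∞ y e ≈ 0#) → D ≡ just e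
  HasDegree-unique {D = nothing} {e} y≃0 _ yₑ≉0 = ⊥-elim (yₑ≉0 (trans (coef-≈ y≃0 e) (coef-0∞ e)))
  HasDegree-unique {D = just d} {e} (y≤d , yd≉0) y≤e yₑ≉0 with ℤP.<-cmp d e
  ... | tri< d<e _ _ = ⊥-elim (yₑ≉0 (y≤d e d<e))
  ... | tri≈ _ d≡e _ = ≡.cong just d≡e
  ... | tri> _ _ e<d = ⊥-elim (yd≉0 (y≤e d e<d))

module GramSeries {c ℓ : Level} (F : FiniteField c ℓ) where
  open FiniteField F hiding (zero)
  open Over F
  open LaurentSeries F
  open Embedding F
  open Representatives F
  private module K = CommutativeRing K∞-ring
  open K∞Solver using (solve; Polynomial; _:+_; _:*_; _:-_; _:=_; :-_; con)

  form : ∀ {n} (y₀₀ y₀₁ y₀₂ y₁₀ y₁₁ y₁₂ y₂₀ y₂₁ y₂₂ x₀ x₁ x₂ : Polynomial n) → Polynomial n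
  form y₀₀ y₀₁ y₀₂ y₁₀ y₁₁ y₁₂ y₂₀ y₂₁ y₂₂ x₀ x₁ x₂ =
    ((y₀₀ :* x₀) :* x₀ :+ ((y₀₁ :* x₀) :* x₁ :+ (y₀₂ :* x₀) :* x₂))
    :+ (((y₁₀ :* x₁) :* x₀ :+ ((y₁₁ :* x₁) :* x₁ :+ (y₁₂ :* x₁) :* x₂))
    :+ ((y₂₀ :* x₂) :* x₀ :+ ((y₂₁ :* x₂) :* x₁ :+ (y₂₂ :* x₂) :* x₂)))

  pattern i₀ = Fin.zero
  pattern i₁ = Fin.suc Fin.zero
  pattern i₂ = Fin.suc (Fin.suc Fin.zero)

  triple : K∞ → K∞ → K∞ → Fin 3 → K∞
  triple x y z i₀ = x
  triple x y z i₁ = y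
  triple x y z i₂ = z

  sum3∞-cong : ∀ {f g : Fin 3 → K∞} → (∀ i → f i ≃ g i) → sum3∞ f ≃ sum3∞ g
  sum3∞-cong f≃g = K.+-cong (f≃g i₀) (K.+-cong (f≃g i₁) (f≃g i₂))

  represents-sum3 : ∀ (f′ : Fin 3 → K∞) (f : Fin 3 → Frac) → (∀ i → f′ i represents f i) → sum3∞ f′ represents sum3K f
  represents-sum3 f′ f rep = represents-+K (f i₀) (f i₁ +K f i₂) (rep i₀) (represents-+K (f i₁) (f i₂) (rep i₁) (rep i₂))

  sum3K-IsK : ∀ (f : Fin 3 → Frac) → (∀ i → IsK (f i)) → IsK (sum3K f)
  sum3K-IsK f f∈K = +K-IsK (f i₀) (f i₁ +K f i₂) (f∈K i₀) (+K-IsK (f i₁) (f i₂) (f∈K i₁) (f∈K i₂))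

  module Forms (m : Gram) (m∈K : ∀ i j → IsK (m i j)) where

    Y : Fin 3 → Fin 3 → K∞
    Y i j = proj₁ (represented (m i j) (m∈K i j))

    Y-represents : ∀ i j → Y i j represents m i j
    Y-represents i j = proj₂ (represented (m i j) (m∈K i j))

    Y-sym : (∀ i j → m i j ≈K m j i) → ∀ i j → Y i j ≃ Y j i
    Y-sym m-sym i j = represents-unique (m∈K i j) (m∈K j i) (m-sym i j) (Y-represents i j) (Y-represents j i)

    Q∞ : (Fin 3 → K∞) → K∞
    Q∞ x = sum3∞ (λ i → sum3∞ (λ j → (Y i j *∞ x i) *∞ x j))

    B∞ : (Fin 3 → K∞) → (Fin 3 → K∞) → K∞
    B∞ x y = (Q∞ (λ i → x i +∞ y i) +∞ (-∞ Q∞ x)) +∞ (-∞ Q∞ y)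

    Q∞-cong : ∀ {x x′} → (∀ i → x i ≃ x′ i) → Q∞ x ≃ Q∞ x′
    Q∞-cong {x} {x′} x≃x′ = sum3∞-cong (λ i → sum3∞-cong (λ j → K.*-cong (K.*-congˡ {Y i j} (x≃x′ i)) (x≃x′ j)))

    B∞-cong : ∀ {x x′ y y′} → (∀ i → x i ≃ x′ i) → (∀ i → y i ≃ y′ i) → B∞ x y ≃ B∞ x′ y′
    B∞-cong {x} {x′} {y} {y′} x≃x′ y≃y′ =
      K.+-cong (K.+-cong (Q∞-cong {λ i → x i +∞ y i} {λ i → x′ i +∞ y′ i} (λ i → K.+-cong (x≃x′ i) (y≃y′ i)))
                         (K.-‿cong (Q∞-cong {x} {x′} x≃x′)))
               (K.-‿cong (Q∞-cong {y} {y′} y≃y′))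

    Q∞-represents : ∀ x → Q∞ (λ i → emb (x i)) represents QL m x
    Q∞-represents x = represents-sum3 (λ i → sum3∞ (term∞ i)) (λ i → sum3K (termK i)) (λ i →
      represents-sum3 (term∞ i) (termK i) (λ j → represents-*K (m i j *K ι (x i)) (ι (x j))
        (represents-*K (m i j) (ι (x i)) (Y-represents i j) (represents-ι (x i))) (represents-ι (x j))))
      where
      term∞ : Fin 3 → Fin 3 → K∞
      term∞ i j = (Y i j *∞ emb (x i)) *∞ emb (x j)
      termK : Fin 3 → Fin 3 → Frac
      termK i j = (m i j *K ι (x i)) *K ι (x j)

    QL-IsK : ∀ x → IsK (QL m x)
    QL-IsK x = sum3K-IsK (λ i → sum3K (termK i)) (λ i → sum3K-IsK (termK i) (λ j →
      *K-IsK (m i j *K ι (x i)) (ι (x j)) (*K-IsK (m i j) (ι (x i)) (m∈K i j) (ι-IsK (x i))) (ι-IsK (x j))))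
      where
      termK : Fin 3 → Fin 3 → Frac
      termK i j = (m i j *K ι (x i)) *K ι (x j)

    B∞-represents : ∀ x y → B∞ (λ i → emb (x i)) (λ i → emb (y i)) represents BL m x y
    B∞-represents x y = represents-+K (QL m x+y +K (-K QL m x)) (-K QL m y)
      (represents-+K (QL m x+y) (-K QL m x)
        (represents-cong (Q∞-cong {λ i → emb (x+y i)} (λ i → emb-+ₚ (x i) (y i))) (Q∞-represents x+y))
        (represents-negK (QL m x) (Q∞-represents x)))
      (represents-negK (QL m y) (Q∞-represents y))
      where
      x+y = λ i → x i +ₚ y i

    BL-IsK : ∀ x y → IsK (BL m x y)
    BL-IsK x y = +K-IsK (QL m x+y +K (-K QL m x)) (-K QL m y)
      (+K-IsK (QL m x+y) (-K QL m x) (QL-IsK x+y) (-K-IsK (QL m x) (QL-IsK x))) (-K-IsK (QL m y) (QL-IsK y))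
      where
      x+y = λ i → x i +ₚ y i

    Q∞-plane : ∀ A B → Q∞ (triple A B 0∞) ≃
      (((Y i₀ i₀ *∞ A) *∞ A) +∞ ((Y i₁ i₁ *∞ B) *∞ B)) +∞ (((Y i₀ i₁ +∞ Y i₁ i₀) *∞ A) *∞ B)
    Q∞-plane A B = solve 11 (λ y₀₀ y₀₁ y₀₂ y₁₀ y₁₁ y₁₂ y₂₀ y₂₁ y₂₂ A B →
        form y₀₀ y₀₁ y₀₂ y₁₀ y₁₁ y₁₂ y₂₀ y₂₁ y₂₂ A B (con (+ 0))
      := ((y₀₀ :* A) :* A :+ (y₁₁ :* B) :* B) :+ ((y₀₁ :+ y₁₀) :* A) :* B)
      K.refl (Y i₀ i₀) (Y i₀ i₁) (Y i₀ i₂) (Y i₁ i₀) (Y i₁ i₁) (Y i₁ i₂) (Y i₂ i₀) (Y i₂ i₁) (Y i₂ i₂) A B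

    B∞-plane-v₃ : ∀ A B → B∞ (triple A B 0∞) (triple 0∞ 0∞ 1∞) ≃ ((Y i₀ i₂ +∞ Y i₂ i₀) *∞ A) +∞ ((Y i₁ i₂ +∞ Y i₂ i₁) *∞ B)
    B∞-plane-v₃ A B = solve 11 (λ y₀₀ y₀₁ y₀₂ y₁₀ y₁₁ y₁₂ y₂₀ y₂₁ y₂₂ A B →
        (form y₀₀ y₀₁ y₀₂ y₁₀ y₁₁ y₁₂ y₂₀ y₂₁ y₂₂ (A :+ con (+ 0)) (B :+ con (+ 0)) (con (+ 0) :+ con (+ 1))
          :+ (:- form y₀₀ y₀₁ y₀₂ y₁₀ y₁₁ y₁₂ y₂₀ y₂₁ y₂₂ A B (con (+ 0))))
          :+ (:- form y₀₀ y₀₁ y₀₂ y₁₀ y₁₁ y₁₂ y₂₀ y₂₁ y₂₂ (con (+ 0)) (con (+ 0)) (con (+ 1)))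
      := ((y₀₂ :+ y₂₀) :* A) :+ ((y₁₂ :+ y₂₁) :* B))
      K.refl (Y i₀ i₀) (Y i₀ i₁) (Y i₀ i₂) (Y i₁ i₀) (Y i₁ i₁) (Y i₁ i₂) (Y i₂ i₀) (Y i₂ i₁) (Y i₂ i₂) A B

module Anisotropy {c ℓ : Level} (F : FiniteField c ℓ) (q-odd : FiniteField.q F % 2 ≡ 1)
                  (m : Over.Gram F) (isGram : Over.IsGram F m) (definite : Over.Definite F m) where
  open FiniteField F hiding (zero)
  open Over F
  open FieldProperties F using (*-nonzero; inverse-nonzero; ratio-square; odd-order⇒2#≉0)
  open LaurentSeries F
  open LaurentDegrees F
  open GramSeries F
  open Forms m (proj₁ isGram)
  open IntegerArithmetic using (midpoint; [i-1]+[i-1]<i+j)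
  private module K = CommutativeRing K∞-ring
  open import Relation.Binary.Reasoning.Setoid K.setoid
  open K∞Solver using (solve; _:+_; _:*_; _:-_; _:=_)

  discriminant : K∞
  discriminant = (Y i₀ i₁ *∞ Y i₀ i₁) +∞ (-∞ (Y i₀ i₀ *∞ Y i₁ i₁))

  square-root⇒isotropic : ∀ s → s *∞ s ≃ discriminant → Q∞ (triple (s +∞ (-∞ Y i₀ i₁)) (Y i₀ i₀) 0∞) ≃ 0∞
  square-root⇒isotropic s s²≃D = begin
    Q∞ (triple x Y₀₀ 0∞)
      ≈⟨ Q∞-plane x Y₀₀ ⟩
    (((Y₀₀ *∞ x) *∞ x) +∞ ((Y₁₁ *∞ Y₀₀) *∞ Y₀₀)) +∞ (((Y₀₁ +∞ Y₁₀) *∞ x) *∞ Y₀₀)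
      ≈⟨ solve 5 (λ s y₀₀ y₀₁ y₁₀ y₁₁ →
           ((y₀₀ :* (s :- y₀₁)) :* (s :- y₀₁) :+ (y₁₁ :* y₀₀) :* y₀₀) :+ ((y₀₁ :+ y₁₀) :* (s :- y₀₁)) :* y₀₀
           := y₀₀ :* ((s :* s) :- ((y₀₁ :* y₀₁) :- (y₀₀ :* y₁₁))) :+ (y₁₀ :- y₀₁) :* ((s :- y₀₁) :* y₀₀))
         K.refl s Y₀₀ Y₀₁ Y₁₀ Y₁₁ ⟩
    (Y₀₀ *∞ ((s *∞ s) +∞ (-∞ discriminant))) +∞ ((Y₁₀ +∞ (-∞ Y₀₁)) *∞ (x *∞ Y₀₀))
      ≈⟨ K.+-cong (K.*-congˡ {Y₀₀} (K.trans (K.+-congʳ s²≃D) (K.-‿inverseʳ discriminant)))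
                  (K.*-congʳ {x *∞ Y₀₀} (K.trans (K.+-congʳ (Y-sym (proj₂ isGram) i₁ i₀)) (K.-‿inverseʳ Y₀₁))) ⟩
    (Y₀₀ *∞ 0∞) +∞ (0∞ *∞ (x *∞ Y₀₀))
      ≈⟨ K.trans (K.+-cong (K.zeroʳ Y₀₀) (K.zeroˡ (x *∞ Y₀₀))) (K.+-identityʳ 0∞) ⟩
    0∞ ∎
    where
    Y₀₀ = Y i₀ i₀
    Y₀₁ = Y i₀ i₁
    Y₁₀ = Y i₁ i₀
    Y₁₁ = Y i₁ i₁
    x = s +∞ (-∞ Y₀₁)

  leading-terms-cancel⇒⊥ :
    ∀ {d₀ d₁ y₀ y₁} → Leading (Y i₀ i₀) d₀ y₀ → ¬ (y₀ ≈ 0#) → Leading (Y i₁ i₁) d₁ y₁ →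
    Deg≤ (Y i₀ i₁) (d₀ ℤ.- ℤ.1ℤ) → d₀ ℤ.≤ d₁ →
    ∀ {α β a b} → ¬ (a ≈ 0#) → ¬ (b ≈ 0#) → (d₀ ℤ.+ α) ℤ.+ α ≡ (d₁ ℤ.+ β) ℤ.+ β →
    ¬ ((y₀ * a) * a + (y₁ * b) * b ≈ 0#)
  leading-terms-cancel⇒⊥ {d₀} {d₁} {y₀} {y₁} Y₀₀-leading y₀≉0 Y₁₁-leading Y₀₁≤d₀-1 d₀≤d₁ {α} {β} {a} {b} a≉0 b≉0 balanced cancel =
    y₀≉0 (trans (sym (proj₂ Y₀₀-leading)) (trans (Y₀₀≈0 d₀) (coef-0∞ d₀)))
    where
    b⁻¹ = proj₁ (inverse b b≉0)
    bb⁻¹≈1 = proj₂ (inverse b b≉0)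
    r = (y₀ * a) * b⁻¹
    r≉0 : ¬ (r ≈ 0#)
    r≉0 = *-nonzero (*-nonzero y₀≉0 a≉0) (inverse-nonzero (trans (*-comm b⁻¹ b) bb⁻¹≈1))
    e = (d₁ ℤ.+ β) ℤ.- α
    D-leading : Leading discriminant (e ℤ.+ e) (r * r)
    D-leading = ≡.subst (λ k → Leading discriminant k (r * r)) (≡.sym (midpoint d₀ d₁ α β balanced))
      (Leading-≈ (trans (+-identityˡ _) (sym (ratio-square bb⁻¹≈1 cancel)))
        (Leading-+ (Leading-low (proj₁ (Leading-* (Y₀₁≤d₀-1 , refl) (Y₀₁≤d₀-1 , refl))) ([i-1]+[i-1]<i+j d₀≤d₁))
                   (Leading-neg (Leading-* Y₀₀-leading Y₁₁-leading))))
    √D = sqrt∞ discriminant e r D-leading r≉0 (odd-order⇒2#≉0 q-odd)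
    Y₀₀≈0 : Y i₀ i₀ ≈∞ 0∞
    Y₀₀≈0 = definite Y Y-represents (triple (proj₁ √D +∞ (-∞ Y i₀ i₁)) (Y i₀ i₀) 0∞) (coef-≈ (square-root⇒isotropic (proj₁ √D) (proj₂ √D))) i₁

module ReducedPlane {c ℓ : Level} (F : FiniteField c ℓ) (q-odd : FiniteField.q F % 2 ≡ 1)
                    (m : Over.Gram F) (isGram : Over.IsGram F m) (definite : Over.Definite F m)
                    (reduced : Over.Reduced F m) (a b : Over.Poly F) where
  open FiniteField F hiding (zero)
  open Over F
  open FieldProperties F using (*-nonzero)
  open LaurentSeries F
  open LaurentDegrees F
  open Embedding F
  open Representatives F
  open GramSeries F
  open Forms m (proj₁ isGram)
  open Anisotropy F q-odd m isGram definite using (leading-terms-cancel⇒⊥)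
  open IntegerArithmetic using ([d-1]+α<E; [d₀-1]+α+β<E)
  private module K = CommutativeRing K∞-ring

  m∈K : ∀ i j → IsK (m i j)
  m∈K = proj₁ isGram

  <ᵈ⇒just : ∀ {x y} → x <ᵈ y → Σ ℤ λ d → y ≡ just d
  <ᵈ⇒just -∞<      = _ , ≡.refl
  <ᵈ⇒just (fin< _) = _ , ≡.refl

  d₀ d₁ : ℤ
  d₀ = proj₁ (<ᵈ⇒just (proj₂ reduced i₀ i₁ (s≤s z≤n)))
  d₁ = proj₁ (<ᵈ⇒just (proj₂ reduced i₁ i₂ (s≤s (s≤s z≤n))))

  deg-m₀₀ : degK (m i₀ i₀) ≡ just d₀
  deg-m₀₀ = proj₂ (<ᵈ⇒just (proj₂ reduced i₀ i₁ (s≤s z≤n)))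

  deg-m₁₁ : degK (m i₁ i₁) ≡ just d₁
  deg-m₁₁ = proj₂ (<ᵈ⇒just (proj₂ reduced i₁ i₂ (s≤s (s≤s z≤n))))

  d₀≤d₁ : d₀ ℤ.≤ d₁
  d₀≤d₁ with ≡.subst₂ _≤ᵈ_ deg-m₀₀ deg-m₁₁ (proj₁ reduced i₀ i₁ z≤n)
  ... | fin≤ d₀≤d₁ = d₀≤d₁

  diagonal-degree : ∀ i {d} → degK (m i i) ≡ just d → Deg≤ (Y i i) d × ¬ (coef∞ (Y i i) d ≈ 0#)
  diagonal-degree i deg-mᵢᵢ = ≡.subst (HasDegree (Y i i)) deg-mᵢᵢ (represents⇒HasDegree (m∈K i i) (Y-represents i i))

  off-diagonal-degree : ∀ i j {d} → i Fin.< j → degK (m i i) ≡ just d → Deg≤ (Y i j) (d ℤ.- ℤ.1ℤ) × Deg≤ (Y j i) (d ℤ.- ℤ.1ℤ)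
  off-diagonal-degree i j i<j deg-mᵢᵢ = Yᵢⱼ≤ , Deg≤-cong (Y-sym (proj₂ isGram) i j) Yᵢⱼ≤
    where
    Yᵢⱼ≤ = Deg<⇒Deg≤ (HasDegree-<ᵈ (represents⇒HasDegree (m∈K i j) (Y-represents i j))
                                   (≡.subst (degK (m i j) <ᵈ_) deg-mᵢᵢ (proj₂ reduced i j i<j)))

  y₀ y₁ : Carrier
  y₀ = coef∞ (Y i₀ i₀) d₀
  y₁ = coef∞ (Y i₁ i₁) d₁

  A B : K∞
  A = emb a
  B = emb b

  Y₀₁+Y₁₀≤ : Deg≤ (Y i₀ i₁ +∞ Y i₁ i₀) (d₀ ℤ.- ℤ.1ℤ)
  Y₀₁+Y₁₀≤ = proj₁ (Leading-+ (proj₁ (off-diagonal-degree i₀ i₁ (s≤s z≤n) deg-m₀₀) , refl) (proj₂ (off-diagonal-degree i₀ i₁ (s≤s z≤n) deg-m₀₀) , refl))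

  Y₀₂+Y₂₀≤ : Deg≤ (Y i₀ i₂ +∞ Y i₂ i₀) (d₀ ℤ.- ℤ.1ℤ)
  Y₀₂+Y₂₀≤ = proj₁ (Leading-+ (proj₁ (off-diagonal-degree i₀ i₂ (s≤s z≤n) deg-m₀₀) , refl) (proj₂ (off-diagonal-degree i₀ i₂ (s≤s z≤n) deg-m₀₀) , refl))

  Y₁₂+Y₂₁≤ : Deg≤ (Y i₁ i₂ +∞ Y i₂ i₁) (d₁ ℤ.- ℤ.1ℤ)
  Y₁₂+Y₂₁≤ = proj₁ (Leading-+ (proj₁ (off-diagonal-degree i₁ i₂ (s≤s (s≤s z≤n)) deg-m₁₁) , refl) (proj₂ (off-diagonal-degree i₁ i₂ (s≤s (s≤s z≤n)) deg-m₁₁) , refl))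

  U₁ U₂ U₃ S₁ S₂ : K∞
  U₁ = (Y i₀ i₀ *∞ A) *∞ A
  U₂ = (Y i₁ i₁ *∞ B) *∞ B
  U₃ = ((Y i₀ i₁ +∞ Y i₁ i₀) *∞ A) *∞ B
  S₁ = (Y i₀ i₂ +∞ Y i₂ i₀) *∞ A
  S₂ = (Y i₁ i₂ +∞ Y i₂ i₁) *∞ B

  w : Vec3
  w = inM a b

  emb-w : ∀ i → emb (w i) ≃ triple A B 0∞ i
  emb-w i₀ = K.refl
  emb-w i₁ = K.refl
  emb-w i₂ = emb-0ₚ

  emb-v₃ : ∀ i → emb (v₃ i) ≃ triple 0∞ 0∞ 1∞ i
  emb-v₃ i₀ = emb-0ₚ
  emb-v₃ i₁ = emb-0ₚ
  emb-v₃ i₂ = emb-1ₚ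

  Q-w : Q∞ (λ i → emb (w i)) ≃ (U₁ +∞ U₂) +∞ U₃
  Q-w = K.trans (Q∞-cong {λ i → emb (w i)} emb-w) (Q∞-plane A B)

  B-w-v₃ : B∞ (λ i → emb (w i)) (λ i → emb (v₃ i)) ≃ S₁ +∞ S₂
  B-w-v₃ = K.trans (B∞-cong {λ i → emb (w i)} {_} {λ i → emb (v₃ i)} emb-w emb-v₃) (B∞-plane-v₃ A B)

  conclude : ∀ E {u₁ u₂} → Leading U₁ E u₁ → Leading U₂ E u₂ → Leading U₃ E 0# → ¬ (u₁ + u₂ ≈ 0#) →
             Deg< S₁ E → Deg< S₂ E → degK (BL m w v₃) <ᵈ degK (QL m w)
  conclude E U₁-leading U₂-leading U₃-leading u₁+u₂≉0 S₁<E S₂<E = ≡.subst (degK (BL m w v₃) <ᵈ_) (≡.sym deg-Q)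
    (HasDegree-Deg< (represents⇒HasDegree (BL-IsK w v₃) (B∞-represents w v₃)) (Deg<-cong (K.sym B-w-v₃) (Deg<-+ S₁<E S₂<E)))
    where
    Qw-leading = Leading-cong (K.sym Q-w) (Leading-+ (Leading-+ U₁-leading U₂-leading) U₃-leading)
    deg-Q : degK (QL m w) ≡ just E
    deg-Q = HasDegree-unique (represents⇒HasDegree (QL-IsK w) (Q∞-represents w)) (proj₁ Qw-leading)
                             (λ Qₑ≈0 → u₁+u₂≉0 (trans (sym (+-identityʳ _)) (trans (sym (proj₂ Qw-leading)) Qₑ≈0)))

  module Side₁ (α : ℕ) (deg-a : degₚ a ≡ just α) where
    lead-a = coef∞ A (+ α)
    E₁ = (d₀ ℤ.+ + α) ℤ.+ + α

    lead-a≉0 : ¬ (lead-a ≈ 0#)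
    lead-a≉0 = proj₂ (emb-degree a α deg-a)

    A-leading : Leading A (+ α) lead-a
    A-leading = proj₁ (emb-degree a α deg-a) , refl

    U₁-leading : Leading U₁ E₁ ((y₀ * lead-a) * lead-a)
    U₁-leading = Leading-* (Leading-* (proj₁ (diagonal-degree i₀ deg-m₀₀) , refl) A-leading) A-leading

    u₁≉0 : ¬ ((y₀ * lead-a) * lead-a ≈ 0#)
    u₁≉0 = *-nonzero (*-nonzero (proj₂ (diagonal-degree i₀ deg-m₀₀)) lead-a≉0) lead-a≉0

    S₁<E : ∀ {E} → E₁ ℤ.≤ E → Deg< S₁ E
    S₁<E E₁≤E = Deg≤⇒Deg< (proj₁ (Leading-* (Y₀₂+Y₂₀≤ , refl) A-leading)) ([d-1]+α<E d₀ α E₁≤E)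

  module Side₂ (β : ℕ) (deg-b : degₚ b ≡ just β) where
    lead-b = coef∞ B (+ β)
    E₂ = (d₁ ℤ.+ + β) ℤ.+ + β

    lead-b≉0 : ¬ (lead-b ≈ 0#)
    lead-b≉0 = proj₂ (emb-degree b β deg-b)

    B-leading : Leading B (+ β) lead-b
    B-leading = proj₁ (emb-degree b β deg-b) , refl

    U₂-leading : Leading U₂ E₂ ((y₁ * lead-b) * lead-b)
    U₂-leading = Leading-* (Leading-* (proj₁ (diagonal-degree i₁ deg-m₁₁) , refl) B-leading) B-leading

    u₂≉0 : ¬ ((y₁ * lead-b) * lead-b ≈ 0#)
    u₂≉0 = *-nonzero (*-nonzero (proj₂ (diagonal-degree i₁ deg-m₁₁)) lead-b≉0) lead-b≉0

    S₂<E : ∀ {E} → E₂ ℤ.≤ E → Deg< S₂ E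
    S₂<E E₂≤E = Deg≤⇒Deg< (proj₁ (Leading-* (Y₁₂+Y₂₁≤ , refl) B-leading)) ([d-1]+α<E d₁ β E₂≤E)

  only-v₂ : IsZeroₚ a → ∀ β → degₚ b ≡ just β → degK (BL m w v₃) <ᵈ degK (QL m w)
  only-v₂ a≈0 β deg-b = conclude E₂ (Leading-zero E₂ U₁≃0) U₂-leading (Leading-zero E₂ U₃≃0)
    (λ 0+u₂≈0 → u₂≉0 (trans (sym (+-identityˡ _)) 0+u₂≈0)) (Deg<-zero E₂ S₁≃0) (S₂<E ℤP.≤-refl)
    where
    open Side₂ β deg-b
    A≃0 = emb-zero a a≈0
    U₁≃0 = K.trans (K.*-congˡ {Y i₀ i₀ *∞ A} A≃0) (K.zeroʳ _)
    U₃≃0 = K.trans (K.*-congʳ {B} (K.trans (K.*-congˡ {Y i₀ i₁ +∞ Y i₁ i₀} A≃0) (K.zeroʳ _))) (K.zeroˡ B)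
    S₁≃0 = K.trans (K.*-congˡ {Y i₀ i₂ +∞ Y i₂ i₀} A≃0) (K.zeroʳ _)

  only-v₁ : ∀ α → degₚ a ≡ just α → IsZeroₚ b → degK (BL m w v₃) <ᵈ degK (QL m w)
  only-v₁ α deg-a b≈0 = conclude E₁ U₁-leading (Leading-zero E₁ U₂≃0) (Leading-zero E₁ U₃≃0)
    (λ u₁+0≈0 → u₁≉0 (trans (sym (+-identityʳ _)) u₁+0≈0)) (S₁<E ℤP.≤-refl) (Deg<-zero E₁ S₂≃0)
    where
    open Side₁ α deg-a
    B≃0 = emb-zero b b≈0
    U₂≃0 = K.trans (K.*-congˡ {Y i₁ i₁ *∞ B} B≃0) (K.zeroʳ _)
    U₃≃0 = K.trans (K.*-congˡ {(Y i₀ i₁ +∞ Y i₁ i₀) *∞ A} B≃0) (K.zeroʳ _)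
    S₂≃0 = K.trans (K.*-congˡ {Y i₁ i₂ +∞ Y i₂ i₁} B≃0) (K.zeroʳ _)

  both : ∀ α → degₚ a ≡ just α → ∀ β → degₚ b ≡ just β → degK (BL m w v₃) <ᵈ degK (QL m w)
  both α deg-a β deg-b = by-comparison (ℤP.<-cmp E₁ E₂)
    where
    open Side₁ α deg-a
    open Side₂ β deg-b

    U₃-leading : ∀ {E} → E₁ ℤ.≤ E → E₂ ℤ.≤ E → Leading U₃ E 0#
    U₃-leading E₁≤E E₂≤E = Leading-low (proj₁ (Leading-* (Leading-* (Y₀₁+Y₁₀≤ , refl) A-leading) B-leading))
                                       ([d₀-1]+α+β<E α β d₀≤d₁ E₁≤E E₂≤E)

    by-comparison : Tri (E₁ ℤ.< E₂) (E₁ ≡ E₂) (E₂ ℤ.< E₁) → degK (BL m w v₃) <ᵈ degK (QL m w)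
    by-comparison (tri< E₁<E₂ _ _) =
      conclude E₂ (Leading-low (proj₁ U₁-leading) E₁<E₂) U₂-leading (U₃-leading (ℤP.<⇒≤ E₁<E₂) ℤP.≤-refl)
        (λ 0+u₂≈0 → u₂≉0 (trans (sym (+-identityˡ _)) 0+u₂≈0)) (S₁<E (ℤP.<⇒≤ E₁<E₂)) (S₂<E ℤP.≤-refl)
    by-comparison (tri> _ _ E₂<E₁) =
      conclude E₁ U₁-leading (Leading-low (proj₁ U₂-leading) E₂<E₁) (U₃-leading ℤP.≤-refl (ℤP.<⇒≤ E₂<E₁))
        (λ u₁+0≈0 → u₁≉0 (trans (sym (+-identityʳ _)) u₁+0≈0)) (S₁<E ℤP.≤-refl) (S₂<E (ℤP.<⇒≤ E₂<E₁))
    by-comparison (tri≈ _ E₁≡E₂ _) =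
      conclude E₁ U₁-leading (≡.subst (λ E → Leading U₂ E ((y₁ * lead-b) * lead-b)) (≡.sym E₁≡E₂) U₂-leading)
        (U₃-leading ℤP.≤-refl (ℤP.≤-reflexive (≡.sym E₁≡E₂)))
        (leading-terms-cancel⇒⊥ (proj₁ (diagonal-degree i₀ deg-m₀₀) , refl) (proj₂ (diagonal-degree i₀ deg-m₀₀))
           (proj₁ (diagonal-degree i₁ deg-m₁₁) , refl) (proj₁ (off-diagonal-degree i₀ i₁ (s≤s z≤n) deg-m₀₀)) d₀≤d₁
           lead-a≉0 lead-b≉0 E₁≡E₂)
        (S₁<E ℤP.≤-refl) (S₂<E (ℤP.≤-reflexive (≡.sym E₁≡E₂)))

lemma6p4 : {c ℓ : Level} (F : FiniteField c ℓ) → FiniteField.q F % 2 ≡ 1 →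
    let open Over F in
    (m : Gram) → IsGram m → Definite m → Reduced m →
    (a b : Poly) → ¬ (IsZeroₚ a × IsZeroₚ b) →
    degK (BL m (inM a b) v₃) <ᵈ degK (QL m (inM a b))
lemma6p4 F q-odd m isGram definite reduced a b w≢0 = by-degrees (degₚ a) ≡.refl (degₚ b) ≡.refl
  where
  open Over F
  open Embedding F using (degₚ-nothing)
  open ReducedPlane F q-odd m isGram definite reduced a b

  by-degrees : ∀ α → degₚ a ≡ α → ∀ β → degₚ b ≡ β → degK (BL m (inM a b) v₃) <ᵈ degK (QL m (inM a b))
  by-degrees nothing  deg-a nothing  deg-b = ⊥-elim (w≢0 (degₚ-nothing a deg-a , degₚ-nothing b deg-b))
  by-degrees nothing  deg-a (just β) deg-b = only-v₂ (degₚ-nothing a deg-a) β deg-b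
  by-degrees (just α) deg-a nothing  deg-b = only-v₁ α deg-a (degₚ-nothing b deg-b)
  by-degrees (just α) deg-a (just β) deg-b = both α deg-a β deg-b
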